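{- The family of ternary relations $\langle R_{u,t}\mid u,t\in\omega,\ u\ge t\rangle$ is polynomially existential, where for $a,b,w\in\mathbf M_u$, $R_{u,t}(a,b,w)$ holds iff for all $i<2^{u-t}$: $w[i,t]=0$ implies $a[i,t]\,b[i,t]<2^{2^t}$, and $w[i,t]=1$ implies $a[i,t]\,b[i,t]\ge2^{2^t}$ (products taken in the integers).
   Context: $\mathcal M$ is the first-order language with equality with constants $\mathbf 0,\mathbf 1,-\mathbf 1,\mathbf n$, unary $\mathcal N,\mathbf p$, binary $+,\times,\div,\max,\min,\cap$; $\mathbf M_d$ ($n=2^d$) has universe $\{0,\dots,2^n-1\}$ with $+,\times$ mod $2^n$, $\mathbf p(x)=\min\{2^x,2^n-1\}$, $\div(x,y)=\lfloor x/y\rfloor$ ($0$ for $y=0$), constants $0,1,n,2^n-1$, usual $\max,\min$, bitwise AND $\cap$ and bitwise complement $\mathcal N$. $a[i,t]$ is the $i$-th digit of $a$ in base $2^{2^t}$. A family $\langle R_{u,t}\mid u\ge t\rangle$ of $k$-ary relations, $R_{u,t}$ on $\mathbf M_u$, is polynomially existential if there exist $c\in\omega$ and an existential formula $\phi(x_0,\dots,x_{k-1},y,z)$ of $\mathcal M$ such that for all $v,u,t$ with $u\ge t$ and $v\ge c(u-t)+t$, and all $a_0,\dots,a_{k-1}\in\mathbf M_u$: $R_{u,t}(a_0,\dots,a_{k-1})$ iff $\mathbf M_v\models\phi(a_0,\dots,a_{k-1},u,t)$. -}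

module Defs where

open import Data.Nat using (ℕ; zero; suc; _+_; _*_; _∸_; _^_; _≤_; _<_; _≥_; _⊔_; _⊓_; NonZero)
open import Data.Nat.DivMod using (_/_; _%_)
open import Data.Nat.Properties using (m^n≢0)
open import Data.Vec using (Vec; lookup; _∷_; [])
open import Relation.Binary.PropositionalEquality using (_≡_)
open import Data.Fin using (Fin; fromℕ<)
open import Data.Nat.Properties using (_<?_)
open import Relation.Nullary using (¬_; yes; no)
open import Data.Product using (Σ; _×_; ∃)
open import Data.Sum using (_⊎_)
open import Function.Bundles using (_⇔_)
import Data.Vec.Relation.Unary.All as VAll

mod2^ : ℕ → ℕ → ℕ
mod2^ x k = _%_ x (2 ^ k) {{m^n≢0 2 k}}

div2^ : ℕ → ℕ → ℕ
div2^ x k = _/_ x (2 ^ k) {{m^n≢0 2 k}}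

divZ : ℕ → ℕ → ℕ
divZ x zero    = 0
divZ x (suc y) = x / suc y

andBits : ℕ → ℕ → ℕ → ℕ
andBits zero    x y = 0
andBits (suc k) x y = mod2^ x 1 * mod2^ y 1 + 2 * andBits k (div2^ x 1) (div2^ y 1)

-- The structure M_d : universe {0,…,2^n - 1}, n = 2^d

nOf : ℕ → ℕ
nOf d = 2 ^ d

size : ℕ → ℕ
size d = 2 ^ nOf d

-- The language 𝓜 (variables as de Bruijn indices)

data Term : Set where
  var  : ℕ → Term
  c0 c1 cm1 cn : Term
  𝒩 𝐩 : Term → Term
  _⊕_ _⊗_ _⊘_ _max'_ _min'_ _∩_ : Term → Term → Term

data QF : Set where
  _≈_  : Term → Term → QF
  ¬'_  : QF → QF
  _∧'_ _∨'_ : QF → QF → QF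

data EForm : Set where
  qf : QF → EForm
  ∃' : EForm → EForm

Env : Set
Env = ℕ → ℕ

cons : ℕ → Env → Env
cons a ρ zero    = a
cons a ρ (suc i) = ρ i

eval : (d : ℕ) → Env → Term → ℕ
eval d ρ (var i)      = ρ i
eval d ρ c0           = 0
eval d ρ c1           = 1
eval d ρ cm1          = size d ∸ 1
eval d ρ cn           = nOf d
eval d ρ (𝒩 s)        = (size d ∸ 1) ∸ eval d ρ s
eval d ρ (𝐩 s)        = (2 ^ eval d ρ s) ⊓ (size d ∸ 1)
eval d ρ (s ⊕ r)      = mod2^ (eval d ρ s + eval d ρ r) (nOf d)
eval d ρ (s ⊗ r)      = mod2^ (eval d ρ s * eval d ρ r) (nOf d)
eval d ρ (s ⊘ r)      = divZ (eval d ρ s) (eval d ρ r)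
eval d ρ (s max' r)   = eval d ρ s ⊔ eval d ρ r
eval d ρ (s min' r)   = eval d ρ s ⊓ eval d ρ r
eval d ρ (s ∩ r)      = andBits (nOf d) (eval d ρ s) (eval d ρ r)

SatQF : (d : ℕ) → Env → QF → Set
SatQF d ρ (s ≈ r)   = eval d ρ s ≡ eval d ρ r
SatQF d ρ (¬' φ)    = ¬ SatQF d ρ φ
SatQF d ρ (φ ∧' ψ)  = SatQF d ρ φ × SatQF d ρ ψ
SatQF d ρ (φ ∨' ψ)  = SatQF d ρ φ ⊎ SatQF d ρ ψ

Sat : (d : ℕ) → Env → EForm → Set
Sat d ρ (qf φ) = SatQF d ρ φ
Sat d ρ (∃' φ) = Σ ℕ λ x → x < size d × Sat d (cons x ρ) φ

-- environment assigning a₀,…,a_{k-1}, u, t to variables 0,…,k+1 (rest 0)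
envOf : {k : ℕ} → Vec ℕ k → ℕ → ℕ → Env
envOf {k} as u t i with i <? k
... | yes i<k = lookup as (fromℕ< i<k)
... | no _ with i ∸ k
...   | zero        = u
...   | suc zero    = t
...   | suc (suc _) = 0

PolyExistential : (k : ℕ) → (ℕ → ℕ → Vec ℕ k → Set) → Set
PolyExistential k R =
  Σ ℕ λ c → Σ EForm λ φ →
    ∀ v u t → t ≤ u → c * (u ∸ t) + t ≤ v →
    (as : Vec ℕ k) → VAll.All (λ a → a < size u) as →
    (R u t as ⇔ Sat v (envOf as u t) φ)

-- digits: a[i,t] = i-th digit of a in base 2^(2^t)

digit : ℕ → ℕ → ℕ → ℕ
digit a i t = mod2^ (div2^ a (i * 2 ^ t)) (2 ^ t)

R56 : ℕ → ℕ → Vec ℕ 3 → Set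
R56 u t (a ∷ b ∷ w ∷ []) =
  ∀ i → i < 2 ^ (u ∸ t) →
    (digit w i t ≡ 0 → digit a i t * digit b i t < 2 ^ (2 ^ t)) ×
    (digit w i t ≡ 1 → digit a i t * digit b i t ≥ 2 ^ (2 ^ t))

-- For t = u the relation concerns the single digit a[0] b[0] = a b, and a b < 2^n is tested by
-- computing a ⊗ b in M_v and dividing back by a.  For t < u, with s = 2^t and m = 2^(u − t)
-- digits, multiplication by repunits and masking with ∩ spread the digits of a, b and w into
-- blocks of width D = 2n + s, placed so that the single product A B carries every a[i] b[i] in a
-- block of its own, aligned with w[i].  Blockwise arithmetic with constant offsets then turns
-- each diagonal block into the flag [a[i] b[i] ≥ 2^s] + w[i], and the relation holds iff no
-- diagonal block equals 1.  This is one equation between numerals in base 2^D, so the formula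
-- is even quantifier-free; all values have at most D m (m + 1) + s + 2 ≤ 2^v bits as soon as
-- v ≥ 8 (u − t) + t.
module Submission where

open import Defs
open import Data.Nat
open import Data.Nat.Properties
open import Data.Nat.DivMod
open import Data.Nat.Divisibility using (divides)
open import Relation.Binary.PropositionalEquality
open import Data.Nat.Tactic.RingSolver
open import Relation.Nullary
open import Data.Empty
open import Data.Product
open import Data.Sum
open import Data.Vec using (Vec; _∷_; [])
open import Function.Base using (_∘_)
open import Function.Bundles using (_⇔_; mk⇔)
import Data.Vec.Relation.Unary.All as VAll

2^>0 : ∀ k → 1 ≤ 2 ^ k
2^>0 k = m^n>0 2 k

2^-monoʳ-< : ∀ a b → a < b → 2 ^ a < 2 ^ b
2^-monoʳ-< a b a<b = ^-monoʳ-< 2 (s≤s (s≤s z≤n)) a<b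

2^-monoʳ-≤ : ∀ a b → a ≤ b → 2 ^ a ≤ 2 ^ b
2^-monoʳ-≤ a b a≤b = ^-monoʳ-≤ 2 a≤b

2^[1+p]≡2^p+2^p : ∀ p → 2 ^ suc p ≡ 2 ^ p + 2 ^ p
2^[1+p]≡2^p+2^p p = cong (2 ^ p +_) (+-identityʳ (2 ^ p))

n<2^n : ∀ n → n < 2 ^ n
n<2^n zero = s≤s z≤n
n<2^n (suc n) = subst (suc (suc n) ≤_) (sym (2^[1+p]≡2^p+2^p n)) (+-mono-≤ (2^>0 n) (n<2^n n))

2^[1+j]∸1 : ∀ j → 2 ^ suc j ∸ 1 ≡ 1 + 2 * (2 ^ j ∸ 1)
2^[1+j]∸1 j = begin
    2 * 2 ^ j ∸ 1
  ≡⟨ cong (λ z → 2 * z ∸ 1) (sym (m∸n+n≡m (2^>0 j))) ⟩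
    2 * (2 ^ j ∸ 1 + 1) ∸ 1
  ≡⟨ cong (_∸ 1) (distrib (2 ^ j ∸ 1)) ⟩
    1 + 2 * (2 ^ j ∸ 1)
  ∎
  where
  open ≡-Reasoning
  distrib : ∀ a → 2 * (a + 1) ≡ suc (1 + 2 * a)
  distrib = solve-∀

divZ≡/ : ∀ x y .{{_ : NonZero y}} → divZ x y ≡ x / y
divZ≡/ x (suc y) = refl

[r+q*d]%d≡r : ∀ q r d .{{_ : NonZero d}} → r < d → (r + q * d) % d ≡ r
[r+q*d]%d≡r q r d r<d = trans ([m+kn]%n≡m%n r q d) (m<n⇒m%n≡m r<d)

[r+q*d]/d≡q : ∀ q r d .{{_ : NonZero d}} → r < d → (r + q * d) / d ≡ q
[r+q*d]/d≡q q r d r<d = trans (+-distrib-/-∣ʳ r (divides q refl)) (cong₂ _+_ (m<n⇒m/n≡0 r<d) (m*n/n≡m q d))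

[r+2^D*q]%2^D≡r : ∀ D r q → r < 2 ^ D → mod2^ (r + 2 ^ D * q) D ≡ r
[r+2^D*q]%2^D≡r D r q r<d = trans (cong (λ z → mod2^ (r + z) D) (*-comm (2 ^ D) q)) ([r+q*d]%d≡r q r (2 ^ D) r<d)
  where instance _ = m^n≢0 2 D

[r+2^D*q]/2^D≡q : ∀ D r q → r < 2 ^ D → div2^ (r + 2 ^ D * q) D ≡ q
[r+2^D*q]/2^D≡q D r q r<d = trans (cong (λ z → div2^ (r + z) D) (*-comm (2 ^ D) q)) ([r+q*d]/d≡q q r (2 ^ D) r<d)
  where instance _ = m^n≢0 2 D

x/2^p%2≡1 : ∀ p x → 2 ^ p ≤ x → x < 2 ^ suc p → mod2^ (div2^ x p) 1 ≡ 1
x/2^p%2≡1 p x lo hi = cong (_% 2) (≤-antisym (≤-pred (m<n*o⇒m/o<n {x} {2} {2 ^ p} hi)) (m≥n⇒m/n>0 lo))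
  where instance _ = m^n≢0 2 p

x/2^p%2≡0 : ∀ p x → x < 2 ^ p → mod2^ (div2^ x p) 1 ≡ 0
x/2^p%2≡0 p x hi = cong (_% 2) (m<n⇒m/n≡0 hi)
  where instance _ = m^n≢0 2 p

andBits-split : ∀ D L x y →
  andBits (D + L) x y ≡ andBits D (mod2^ x D) (mod2^ y D) + 2 ^ D * andBits L (div2^ x D) (div2^ y D)
andBits-split zero L x y = sym (trans (+-identityʳ _) (cong₂ (andBits L) (n/1≡n x) (n/1≡n y)))
andBits-split (suc D) L x y = begin
    x % 2 * (y % 2) + 2 * andBits (D + L) (x / 2) (y / 2)
  ≡⟨ cong (λ z → x % 2 * (y % 2) + 2 * z) (andBits-split D L (x / 2) (y / 2)) ⟩
    x % 2 * (y % 2) + 2 * (andBits D (x / 2 % 2 ^ D) (y / 2 % 2 ^ D) + 2 ^ D * andBits L (x / 2 / 2 ^ D) (y / 2 / 2 ^ D))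
  ≡⟨ distrib (x % 2 * (y % 2)) (andBits D (x / 2 % 2 ^ D) (y / 2 % 2 ^ D)) (2 ^ D) (andBits L (x / 2 / 2 ^ D) (y / 2 / 2 ^ D)) ⟩
    x % 2 * (y % 2) + 2 * andBits D (x / 2 % 2 ^ D) (y / 2 % 2 ^ D) + 2 * 2 ^ D * andBits L (x / 2 / 2 ^ D) (y / 2 / 2 ^ D)
  ≡⟨ cong₂ _+_ (cong₂ _+_ (cong₂ _*_ (sym (lowBit x)) (sym (lowBit y))) (cong (2 *_) (cong₂ (andBits D) (sym (shiftLow x)) (sym (shiftLow y)))))
               (cong (2 * 2 ^ D *_) (cong₂ (andBits L) (m/n/o≡m/[n*o] x 2 (2 ^ D)) (m/n/o≡m/[n*o] y 2 (2 ^ D)))) ⟩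
    x % 2 ^ suc D % 2 * (y % 2 ^ suc D % 2) + 2 * andBits D (x % 2 ^ suc D / 2) (y % 2 ^ suc D / 2) + 2 * 2 ^ D * andBits L (x / 2 ^ suc D) (y / 2 ^ suc D)
  ∎
  where
  instance
    _ = m^n≢0 2 D
    _ = m^n≢0 2 (suc D)
    _ = m*n≢0 (2 ^ D) 2
  open ≡-Reasoning
  distrib : ∀ a b c d → a + 2 * (b + c * d) ≡ a + 2 * b + 2 * c * d
  distrib = solve-∀
  lowBit : ∀ z → z % 2 ^ suc D % 2 ≡ z % 2
  lowBit z = m∣n⇒o%n%m≡o%m 2 (2 ^ suc D) z (divides (2 ^ D) (*-comm 2 (2 ^ D)))
  shiftLow : ∀ z → z % 2 ^ suc D / 2 ≡ z / 2 % 2 ^ D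
  shiftLow z = trans (/-congˡ (%-congʳ (*-comm 2 (2 ^ D)))) (m%[n*o]/o≡m/o%n z (2 ^ D) 2)

andBits-zeroʳ : ∀ k x → andBits k x 0 ≡ 0
andBits-zeroʳ zero x = refl
andBits-zeroʳ (suc k) x = cong₂ _+_ (*-zeroʳ (x % 2)) (cong (2 *_) (andBits-zeroʳ k (x / 2)))

andBits-zeroˡ : ∀ k y → andBits k 0 y ≡ 0
andBits-zeroˡ zero y = refl
andBits-zeroˡ (suc k) y = cong (2 *_) (andBits-zeroˡ k (y / 2))

andBits-< : ∀ k x y → andBits k x y < 2 ^ k
andBits-< zero x y = s≤s z≤n
andBits-< (suc k) x y = bit+2*<2* (andBits-< k (x / 2) (y / 2))
  where
  lowBits≤1 : x % 2 * (y % 2) ≤ 1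
  lowBits≤1 = *-mono-≤ {x % 2} {1} {y % 2} {1} (s≤s⁻¹ (m%n<n x 2)) (s≤s⁻¹ (m%n<n y 2))
  bit+2*<2* : ∀ {a c} → a < c → x % 2 * (y % 2) + 2 * a < 2 * c
  bit+2*<2* {a} {c} a<c = ≤-trans (s≤s (+-monoˡ-≤ (2 * a) lowBits≤1)) (subst (_≤ 2 * c) (*-suc 2 a) (*-monoʳ-≤ 2 a<c))

andBits-truncate : ∀ M e x y → x < 2 ^ M → y < 2 ^ M → andBits (M + e) x y ≡ andBits M x y
andBits-truncate M e x y x< y< = begin
    andBits (M + e) x y
  ≡⟨ andBits-split M e x y ⟩
    andBits M (x % 2 ^ M) (y % 2 ^ M) + 2 ^ M * andBits e (x / 2 ^ M) (y / 2 ^ M)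
  ≡⟨ cong₂ _+_ (cong₂ (andBits M) (m<n⇒m%n≡m x<) (m<n⇒m%n≡m y<))
       (cong (2 ^ M *_) (trans (cong₂ (andBits e) (m<n⇒m/n≡0 x<) (m<n⇒m/n≡0 y<)) (andBits-zeroˡ e 0))) ⟩
    andBits M x y + 2 ^ M * 0
  ≡⟨ cong (andBits M x y +_) (*-zeroʳ (2 ^ M)) ⟩
    andBits M x y + 0
  ≡⟨ +-identityʳ _ ⟩
    andBits M x y
  ∎
  where
  instance _ = m^n≢0 2 M
  open ≡-Reasoning

andBits-concat : ∀ D L x x' y y' → x < 2 ^ D → y < 2 ^ D →
  andBits (D + L) (x + 2 ^ D * x') (y + 2 ^ D * y') ≡ andBits D x y + 2 ^ D * andBits L x' y'
andBits-concat D L x x' y y' x< y< = trans (andBits-split D L _ _)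
  (cong₂ _+_ (cong₂ (andBits D) ([r+2^D*q]%2^D≡r D x x' x<) ([r+2^D*q]%2^D≡r D y y' y<))
             (cong (2 ^ D *_) (cong₂ (andBits L) ([r+2^D*q]/2^D≡q D x x' x<) ([r+2^D*q]/2^D≡q D y y' y<))))

andBits-ones : ∀ j z → z < 2 ^ j → andBits j z (2 ^ j ∸ 1) ≡ z
andBits-ones zero zero z< = refl
andBits-ones zero (suc z) (s≤s ())
andBits-ones (suc j) z z< = begin
    z % 2 * ((2 ^ suc j ∸ 1) % 2) + 2 * andBits j (z / 2) ((2 ^ suc j ∸ 1) / 2)
  ≡⟨ cong₂ (λ p q → z % 2 * p + 2 * andBits j (z / 2) q)
       (trans (cong (_% 2) (2^[1+j]∸1 j)) ([r+2^D*q]%2^D≡r 1 1 (2 ^ j ∸ 1) (s≤s (s≤s z≤n))))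
       (trans (cong (_/ 2) (2^[1+j]∸1 j)) ([r+2^D*q]/2^D≡q 1 1 (2 ^ j ∸ 1) (s≤s (s≤s z≤n)))) ⟩
    z % 2 * 1 + 2 * andBits j (z / 2) (2 ^ j ∸ 1)
  ≡⟨ cong₂ _+_ (*-identityʳ (z % 2)) (cong (2 *_) (andBits-ones j (z / 2) (m<n*o⇒m/o<n {z} {2 ^ j} {2} (subst (z <_) (*-comm 2 (2 ^ j)) z<)))) ⟩
    z % 2 + 2 * (z / 2)
  ≡⟨ cong (z % 2 +_) (*-comm 2 (z / 2)) ⟩
    z % 2 + z / 2 * 2
  ≡⟨ sym (m≡m%n+[m/n]*n z 2) ⟩
    z
  ∎
  where open ≡-Reasoning

andBits-shift : ∀ p L x y → andBits (p + L) x (2 ^ p * y) ≡ 2 ^ p * andBits L (div2^ x p) y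
andBits-shift p L x y = begin
    andBits (p + L) x (2 ^ p * y)
  ≡⟨ andBits-split p L x (2 ^ p * y) ⟩
    andBits p (x % 2 ^ p) ((2 ^ p * y) % 2 ^ p) + 2 ^ p * andBits L (x / 2 ^ p) ((2 ^ p * y) / 2 ^ p)
  ≡⟨ cong₂ (λ q r → andBits p (x % 2 ^ p) q + 2 ^ p * andBits L (x / 2 ^ p) r)
       ([r+2^D*q]%2^D≡r p 0 y (2^>0 p)) ([r+2^D*q]/2^D≡q p 0 y (2^>0 p)) ⟩
    andBits p (x % 2 ^ p) 0 + 2 ^ p * andBits L (x / 2 ^ p) y
  ≡⟨ cong (_+ 2 ^ p * andBits L (x / 2 ^ p) y) (andBits-zeroʳ p _) ⟩
    2 ^ p * andBits L (x / 2 ^ p) y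
  ∎
  where
  instance _ = m^n≢0 2 p
  open ≡-Reasoning

andBits-lowMask : ∀ s e z → andBits (s + e) z (2 ^ s ∸ 1) ≡ mod2^ z s
andBits-lowMask s e z = begin
    andBits (s + e) z (2 ^ s ∸ 1)
  ≡⟨ andBits-split s e z (2 ^ s ∸ 1) ⟩
    andBits s (z % 2 ^ s) ((2 ^ s ∸ 1) % 2 ^ s) + 2 ^ s * andBits e (z / 2 ^ s) ((2 ^ s ∸ 1) / 2 ^ s)
  ≡⟨ cong₂ (λ q r → andBits s (z % 2 ^ s) q + 2 ^ s * andBits e (z / 2 ^ s) r)
       (m<n⇒m%n≡m ones<) (m<n⇒m/n≡0 ones<) ⟩
    andBits s (z % 2 ^ s) (2 ^ s ∸ 1) + 2 ^ s * andBits e (z / 2 ^ s) 0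
  ≡⟨ cong₂ _+_ (andBits-ones s (z % 2 ^ s) (m%n<n z (2 ^ s))) (trans (cong (2 ^ s *_) (andBits-zeroʳ e _)) (*-zeroʳ (2 ^ s))) ⟩
    z % 2 ^ s + 0
  ≡⟨ +-identityʳ _ ⟩
    z % 2 ^ s
  ∎
  where
  instance _ = m^n≢0 2 s
  open ≡-Reasoning
  ones< : 2 ^ s ∸ 1 < 2 ^ s
  ones< = ∸-monoʳ-< {2 ^ s} {1} {0} (s≤s z≤n) (2^>0 s)

andBits-field : ∀ p s e x →
  andBits (p + (s + e)) x (2 ^ p * (2 ^ s ∸ 1)) ≡ 2 ^ p * mod2^ (div2^ x p) s
andBits-field p s e x = trans (andBits-shift p (s + e) x (2 ^ s ∸ 1)) (cong (2 ^ p *_) (andBits-lowMask s e (div2^ x p)))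

blocks : ℕ → (ℕ → ℕ) → ℕ → ℕ
blocks D f zero = 0
blocks D f (suc r) = f 0 + 2 ^ D * blocks D (λ i → f (suc i)) r

repunit : ℕ → ℕ → ℕ
repunit D r = blocks D (λ _ → 1) r

Bounded : ℕ → (ℕ → ℕ) → ℕ → Set
Bounded D f r = ∀ i → i < r → f i < 2 ^ D

Bounded-tail : ∀ D f r → Bounded D f (suc r) → Bounded D (λ i → f (suc i)) r
Bounded-tail D f r b i i< = b (suc i) (s≤s i<)

blocks-cong : ∀ D f g r → (∀ i → i < r → f i ≡ g i) → blocks D f r ≡ blocks D g r
blocks-cong D f g zero e = refl
blocks-cong D f g (suc r) e = cong₂ (λ a b → a + 2 ^ D * b) (e 0 (s≤s z≤n))
  (blocks-cong D (λ i → f (suc i)) (λ i → g (suc i)) r (λ i i< → e (suc i) (s≤s i<)))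

blocks-zero : ∀ D f r → (∀ i → i < r → f i ≡ 0) → blocks D f r ≡ 0
blocks-zero D f zero e = refl
blocks-zero D f (suc r) e = trans (cong₂ (λ a b → a + 2 ^ D * b) (e 0 (s≤s z≤n))
  (blocks-zero D (λ i → f (suc i)) r (λ i i< → e (suc i) (s≤s i<)))) (*-zeroʳ (2 ^ D))

blocks-+ : ∀ D f g r → blocks D f r + blocks D g r ≡ blocks D (λ i → f i + g i) r
blocks-+ D f g zero = refl
blocks-+ D f g (suc r) = trans (distrib (f 0) (g 0) (2 ^ D) (blocks D (λ i → f (suc i)) r) (blocks D (λ i → g (suc i)) r))
  (cong (λ z → f 0 + g 0 + 2 ^ D * z) (blocks-+ D (λ i → f (suc i)) (λ i → g (suc i)) r))
  where
  distrib : ∀ a b c x y → a + c * x + (b + c * y) ≡ a + b + c * (x + y)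
  distrib = solve-∀

*-blocks : ∀ D c f r → c * blocks D f r ≡ blocks D (λ i → c * f i) r
*-blocks D c f zero = *-zeroʳ c
*-blocks D c f (suc r) = trans (distrib c (f 0) (2 ^ D) (blocks D (λ i → f (suc i)) r))
  (cong (λ z → c * f 0 + 2 ^ D * z) (*-blocks D c (λ i → f (suc i)) r))
  where
  distrib : ∀ c a d x → c * (a + d * x) ≡ c * a + d * (c * x)
  distrib = solve-∀

2^[D*[1+r]] : ∀ D r → 2 ^ (D * suc r) ≡ 2 ^ D * 2 ^ (D * r)
2^[D*[1+r]] D r = trans (cong (2 ^_) (*-suc D r)) (^-distribˡ-+-* 2 D (D * r))

m+n*o<n*p : ∀ a b A B → a < A → b < B → a + A * b < A * B
m+n*o<n*p a b A B a< b< = ≤-trans (+-monoˡ-≤ (A * b) a<) (subst (_≤ A * B) (*-suc A b) (*-monoʳ-≤ A b<))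

blocks-< : ∀ D f r → Bounded D f r → blocks D f r < 2 ^ (D * r)
blocks-< D f zero b = subst (0 <_) (cong (2 ^_) (sym (*-zeroʳ D))) (s≤s z≤n)
blocks-< D f (suc r) b = subst (blocks D f (suc r) <_) (sym (2^[D*[1+r]] D r))
  (m+n*o<n*p (f 0) _ (2 ^ D) _ (b 0 (s≤s z≤n)) (blocks-< D (λ i → f (suc i)) r (Bounded-tail D f r b)))

andBits-blocks-exact : ∀ D f g r → Bounded D f r → Bounded D g r →
  andBits (D * r) (blocks D f r) (blocks D g r) ≡ blocks D (λ i → andBits D (f i) (g i)) r
andBits-blocks-exact D f g zero bf bg = andBits-zeroˡ (D * 0) 0
andBits-blocks-exact D f g (suc r) bf bg = trans (cong (λ z → andBits z (blocks D f (suc r)) (blocks D g (suc r))) (*-suc D r))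
  (trans (andBits-concat D (D * r) (f 0) _ (g 0) _ (bf 0 (s≤s z≤n)) (bg 0 (s≤s z≤n)))
   (cong (λ z → andBits D (f 0) (g 0) + 2 ^ D * z) (andBits-blocks-exact D (λ i → f (suc i)) (λ i → g (suc i)) r (Bounded-tail D f r bf) (Bounded-tail D g r bg))))

andBits-blocks : ∀ N D f g r → D * r ≤ N → Bounded D f r → Bounded D g r →
  andBits N (blocks D f r) (blocks D g r) ≡ blocks D (λ i → andBits D (f i) (g i)) r
andBits-blocks N D f g r le bf bg = begin
    andBits N (blocks D f r) (blocks D g r)
  ≡⟨ cong (λ z → andBits z (blocks D f r) (blocks D g r)) (sym (m+[n∸m]≡n le)) ⟩
    andBits (D * r + (N ∸ D * r)) (blocks D f r) (blocks D g r)
  ≡⟨ andBits-truncate (D * r) (N ∸ D * r) _ _ (blocks-< D f r bf) (blocks-< D g r bg) ⟩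
    andBits (D * r) (blocks D f r) (blocks D g r)
  ≡⟨ andBits-blocks-exact D f g r bf bg ⟩
    blocks D (λ i → andBits D (f i) (g i)) r
  ∎
  where open ≡-Reasoning

blocks-injective : ∀ D f g r → Bounded D f r → Bounded D g r → blocks D f r ≡ blocks D g r → ∀ i → i < r → f i ≡ g i
blocks-injective D f g (suc r) bf bg eq zero i< =
  trans (sym ([r+2^D*q]%2^D≡r D (f 0) _ (bf 0 (s≤s z≤n)))) (trans (cong (λ z → _%_ z (2 ^ D) {{m^n≢0 2 D}}) eq) ([r+2^D*q]%2^D≡r D (g 0) _ (bg 0 (s≤s z≤n))))
blocks-injective D f g (suc r) bf bg eq (suc i) (s≤s i<) =
  blocks-injective D (λ i → f (suc i)) (λ i → g (suc i)) r (Bounded-tail D f r bf) (Bounded-tail D g r bg)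
    (trans (sym ([r+2^D*q]/2^D≡q D (f 0) _ (bf 0 (s≤s z≤n)))) (trans (cong (λ z → _/_ z (2 ^ D) {{m^n≢0 2 D}}) eq) ([r+2^D*q]/2^D≡q D (g 0) _ (bg 0 (s≤s z≤n)))))
    i i<

blocks-∸ : ∀ D f g r → (∀ i → i < r → g i ≤ f i) → blocks D f r ∸ blocks D g r ≡ blocks D (λ i → f i ∸ g i) r
blocks-∸ D f g r le = begin
    blocks D f r ∸ blocks D g r
  ≡⟨ cong (_∸ blocks D g r) (blocks-cong D f (λ i → (f i ∸ g i) + g i) r (λ i i< → sym (m∸n+n≡m (le i i<)))) ⟩
    blocks D (λ i → (f i ∸ g i) + g i) r ∸ blocks D g r
  ≡⟨ cong (_∸ blocks D g r) (sym (blocks-+ D (λ i → f i ∸ g i) g r)) ⟩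
    blocks D (λ i → f i ∸ g i) r + blocks D g r ∸ blocks D g r
  ≡⟨ m+n∸n≡m (blocks D (λ i → f i ∸ g i) r) (blocks D g r) ⟩
    blocks D (λ i → f i ∸ g i) r
  ∎
  where open ≡-Reasoning

blocks-++ : ∀ D f p q → blocks D f (p + q) ≡ blocks D f p + 2 ^ (D * p) * blocks D (λ i → f (p + i)) q
blocks-++ D f zero q = sym (trans (cong (λ z → 2 ^ z * blocks D f q) (*-zeroʳ D)) (+-identityʳ _))
blocks-++ D f (suc p) q = begin
    f 0 + 2 ^ D * blocks D (λ i → f (suc i)) (p + q)
  ≡⟨ cong (λ z → f 0 + 2 ^ D * z) (blocks-++ D (λ i → f (suc i)) p q) ⟩
    f 0 + 2 ^ D * (blocks D (λ i → f (suc i)) p + 2 ^ (D * p) * blocks D (λ i → f (suc (p + i))) q)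
  ≡⟨ distrib (f 0) (2 ^ D) _ (2 ^ (D * p)) _ ⟩
    f 0 + 2 ^ D * blocks D (λ i → f (suc i)) p + 2 ^ D * 2 ^ (D * p) * blocks D (λ i → f (suc (p + i))) q
  ≡⟨ cong (λ z → f 0 + 2 ^ D * blocks D (λ i → f (suc i)) p + z * blocks D (λ i → f (suc (p + i))) q) (sym (2^[D*[1+r]] D p)) ⟩
    f 0 + 2 ^ D * blocks D (λ i → f (suc i)) p + 2 ^ (D * suc p) * blocks D (λ i → f (suc (p + i))) q
  ∎
  where
  open ≡-Reasoning
  distrib : ∀ a c x d y → a + c * (x + d * y) ≡ a + c * x + c * d * y
  distrib = solve-∀

blocks-chunks : ∀ D f q p → blocks D f (q * p) ≡ blocks (D * p) (λ j → blocks D (λ i → f (j * p + i)) p) q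
blocks-chunks D f zero p = refl
blocks-chunks D f (suc q) p = begin
    blocks D f (p + q * p)
  ≡⟨ blocks-++ D f p (q * p) ⟩
    blocks D f p + 2 ^ (D * p) * blocks D (λ i → f (p + i)) (q * p)
  ≡⟨ cong (λ z → blocks D f p + 2 ^ (D * p) * z) (blocks-chunks D (λ i → f (p + i)) q p) ⟩
    blocks D f p + 2 ^ (D * p) * blocks (D * p) (λ j → blocks D (λ i → f (p + (j * p + i))) p) q
  ≡⟨ cong (λ z → blocks D f p + 2 ^ (D * p) * z) (blocks-cong (D * p) _ _ q (λ j _ →
       blocks-cong D _ _ p (λ i _ → cong f (sym (+-assoc p (j * p) i))))) ⟩
    blocks D f p + 2 ^ (D * p) * blocks (D * p) (λ j → blocks D (λ i → f (suc j * p + i)) p) q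
  ∎
  where open ≡-Reasoning

repunit-geometric : ∀ K r → repunit K r * (2 ^ K ∸ 1) + 1 ≡ 2 ^ (K * r)
repunit-geometric K zero = cong (2 ^_) (sym (*-zeroʳ K))
repunit-geometric K (suc r) = begin
    (1 + 2 ^ K * E) * Q + 1
  ≡⟨ cong (λ z → (1 + z * E) * Q + 1) (sym (m∸n+n≡m (2^>0 K))) ⟩
    (1 + (Q + 1) * E) * Q + 1
  ≡⟨ distrib Q E ⟩
    (Q + 1) * (E * Q + 1)
  ≡⟨ cong₂ _*_ (m∸n+n≡m (2^>0 K)) (repunit-geometric K r) ⟩
    2 ^ K * 2 ^ (K * r)
  ≡⟨ sym (2^[D*[1+r]] K r) ⟩
    2 ^ (K * suc r)
  ∎
  where
  open ≡-Reasoning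
  E Q : ℕ
  E = repunit K r
  Q = 2 ^ K ∸ 1
  distrib : ∀ q e → (1 + (q + 1) * e) * q + 1 ≡ (q + 1) * (e * q + 1)
  distrib = solve-∀

blocks-rebase : ∀ K s f r → blocks K (λ j → 2 ^ (j * s) * f j) r ≡ blocks (K + s) f r
blocks-rebase K s f zero = refl
blocks-rebase K s f (suc r) = begin
    1 * f 0 + 2 ^ K * blocks K (λ j → 2 ^ (suc j * s) * f (suc j)) r
  ≡⟨ cong₂ (λ a b → a + 2 ^ K * b) (*-identityˡ (f 0))
      (blocks-cong K _ (λ j → 2 ^ s * (2 ^ (j * s) * f (suc j))) r (λ j _ →
        trans (cong (_* f (suc j)) (^-distribˡ-+-* 2 s (j * s))) (*-assoc (2 ^ s) _ _))) ⟩
    f 0 + 2 ^ K * blocks K (λ j → 2 ^ s * (2 ^ (j * s) * f (suc j))) r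
  ≡⟨ cong (λ z → f 0 + 2 ^ K * z) (sym (*-blocks K (2 ^ s) _ r)) ⟩
    f 0 + 2 ^ K * (2 ^ s * blocks K (λ j → 2 ^ (j * s) * f (suc j)) r)
  ≡⟨ cong (λ z → f 0 + 2 ^ K * (2 ^ s * z)) (blocks-rebase K s (λ j → f (suc j)) r) ⟩
    f 0 + 2 ^ K * (2 ^ s * blocks (K + s) (λ j → f (suc j)) r)
  ≡⟨ cong (f 0 +_) (trans (sym (*-assoc (2 ^ K) (2 ^ s) _)) (cong (_* blocks (K + s) (λ j → f (suc j)) r) (sym (^-distribˡ-+-* 2 K s)))) ⟩
    f 0 + 2 ^ (K + s) * blocks (K + s) (λ j → f (suc j)) r
  ∎
  where open ≡-Reasoning

isZero : ℕ → ℕ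
isZero zero = 1
isZero (suc _) = 0

blocks-single : ∀ D c p → blocks D (λ i → isZero i * c) (suc p) ≡ c
blocks-single D c p = trans (cong₂ (λ a b → a + 2 ^ D * b) (+-identityʳ c) (blocks-zero D _ p (λ _ _ → refl)))
  (trans (cong (c +_) (*-zeroʳ (2 ^ D))) (+-identityʳ c))

blocks-sparse : ∀ D g q p' → let p = suc p' in
  blocks (D * p) g q ≡ blocks D (λ k → isZero (k % p) * g (k / p)) (q * p)
blocks-sparse D g q p' = sym (trans (blocks-chunks D _ q (suc p'))
  (blocks-cong (D * suc p') _ _ q (λ j _ → trans
     (blocks-cong D _ (λ i → isZero i * g j) (suc p') (λ i i< →
        cong₂ (λ a b → isZero a * g b) (trans (cong (_% suc p') (+-comm (j * suc p') i)) ([r+q*d]%d≡r j i (suc p') i<))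
                                    (trans (cong (_/ suc p') (+-comm (j * suc p') i)) ([r+q*d]/d≡q j i (suc p') i<))))
     (blocks-single D (g j) p'))))

blocks-dropLast : ∀ D f r → f r ≡ 0 → blocks D f (r + 1) ≡ blocks D f r
blocks-dropLast D f r e = trans (blocks-++ D f r 1)
  (trans (cong (λ z → blocks D f r + 2 ^ (D * r) * (z + 2 ^ D * 0)) e')
   (trans (cong (λ z → blocks D f r + 2 ^ (D * r) * z) (*-zeroʳ (2 ^ D))) (trans (cong (blocks D f r +_) (*-zeroʳ (2 ^ (D * r)))) (+-identityʳ _))))
  where
  e' : f (r + 0) ≡ 0
  e' = trans (cong f (+-identityʳ r)) e

blocks-mono : ∀ D f g r → (∀ i → i < r → f i ≤ g i) → blocks D f r ≤ blocks D g r
blocks-mono D f g zero le = z≤n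
blocks-mono D f g (suc r) le = +-mono-≤ (le 0 (s≤s z≤n)) (*-monoʳ-≤ (2 ^ D) (blocks-mono D (λ i → f (suc i)) (λ i → g (suc i)) r (λ i i< → le (suc i) (s≤s i<))))

Bit : ℕ → Set
Bit d = (d ≡ 0) ⊎ (d ≡ 1)

isZero-bit : ∀ k → Bit (isZero k)
isZero-bit zero = inj₂ refl
isZero-bit (suc _) = inj₁ refl

isZero≡1⇒≡0 : ∀ k → isZero k ≡ 1 → k ≡ 0
isZero≡1⇒≡0 zero _ = refl

bit≤1 : ∀ d → Bit d → d ≤ 1
bit≤1 d (inj₁ refl) = z≤n
bit≤1 d (inj₂ refl) = s≤s z≤n

*bit≤ : ∀ c d → Bit d → c * d ≤ c
*bit≤ c d d-bit = ≤-trans (*-monoʳ-≤ c (bit≤1 d d-bit)) (≤-reflexive (*-identityʳ c))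

bit*≤ : ∀ c d → Bit d → d * c ≤ c
bit*≤ c d d-bit = ≤-trans (≤-reflexive (*-comm d c)) (*bit≤ c d d-bit)

andBits-bitMask : ∀ W p x d → Bit d → suc p ≤ W → andBits W x (2 ^ p * d) ≡ 2 ^ p * (d * mod2^ (div2^ x p) 1)
andBits-bitMask W p x d (inj₁ refl) _ =
  trans (cong (andBits W x) (*-zeroʳ (2 ^ p))) (trans (andBits-zeroʳ W x) (sym (*-zeroʳ (2 ^ p))))
andBits-bitMask W p x d (inj₂ refl) p<W =
  trans (cong (λ z → andBits z x (2 ^ p * 1)) (sym width))
        (trans (andBits-field p 1 (W ∸ suc p) x) (cong (2 ^ p *_) (sym (+-identityʳ _))))
  where
  width : p + (1 + (W ∸ suc p)) ≡ W
  width = trans (+-suc p (W ∸ suc p)) (m+[n∸m]≡n p<W)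

x*y<2^[p+q] : ∀ x y p q → x < 2 ^ p → y < 2 ^ q → x * y < 2 ^ (p + q)
x*y<2^[p+q] x y p q x< y< = subst (x * y <_) (sym (^-distribˡ-+-* 2 p q)) (*-mono-< x< y<)

spreadMask-< : ∀ s j r K0 → j < r → r * s ≤ K0 → 2 ^ (j * s) * (2 ^ s ∸ 1) < 2 ^ K0
spreadMask-< s j r K0 j<r rs≤K0 =
  ≤-trans (*-monoʳ-< (2 ^ (j * s)) {{m^n≢0 2 (j * s)}} (∸-monoʳ-< {2 ^ s} {1} {0} (s≤s z≤n) (2^>0 s)))
          (subst (_≤ 2 ^ K0) (^-distribˡ-+-* 2 (j * s) s)
                 (2^-monoʳ-≤ _ _ (≤-trans (≤-reflexive (+-comm (j * s) s)) (≤-trans (*-monoˡ-≤ s j<r) rs≤K0))))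

-- x · repunit K0 r holds r copies of x at stride K0; the mask (2^s − 1) · repunit (K0 + s) r
-- keeps the j-th s-bit digit of the j-th copy, which then sits at position j (K0 + s).
andBits-spread : ∀ s N K0 x r → x < 2 ^ K0 → r * s ≤ K0 → K0 * r ≤ N →
  andBits N (x * repunit K0 r) ((2 ^ s ∸ 1) * repunit (K0 + s) r) ≡ blocks (K0 + s) (λ j → mod2^ (div2^ x (j * s)) s) r
andBits-spread s N K0 x r x< rs≤K0 K0r≤N = begin
    andBits N (x * repunit K0 r) ((2 ^ s ∸ 1) * repunit (K0 + s) r)
  ≡⟨ cong₂ (andBits N) copies masks ⟩
    andBits N (blocks K0 (λ _ → x) r) (blocks K0 (λ j → 2 ^ (j * s) * (2 ^ s ∸ 1)) r)
  ≡⟨ andBits-blocks N K0 _ _ r K0r≤N (λ _ _ → x<) (λ j j< → spreadMask-< s j r K0 j< rs≤K0) ⟩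
    blocks K0 (λ j → andBits K0 x (2 ^ (j * s) * (2 ^ s ∸ 1))) r
  ≡⟨ blocks-cong K0 _ _ r digit-j ⟩
    blocks K0 (λ j → 2 ^ (j * s) * mod2^ (div2^ x (j * s)) s) r
  ≡⟨ blocks-rebase K0 s _ r ⟩
    blocks (K0 + s) (λ j → mod2^ (div2^ x (j * s)) s) r
  ∎
  where
  open ≡-Reasoning
  copies : x * repunit K0 r ≡ blocks K0 (λ _ → x) r
  copies = trans (*-blocks K0 x _ r) (blocks-cong K0 _ _ r (λ _ _ → *-identityʳ x))
  masks : (2 ^ s ∸ 1) * repunit (K0 + s) r ≡ blocks K0 (λ j → 2 ^ (j * s) * (2 ^ s ∸ 1)) r
  masks = trans (*-blocks (K0 + s) (2 ^ s ∸ 1) _ r)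
                (trans (blocks-cong (K0 + s) _ _ r (λ _ _ → *-identityʳ (2 ^ s ∸ 1))) (sym (blocks-rebase K0 s _ r)))
  digit-j : ∀ j → j < r → andBits K0 x (2 ^ (j * s) * (2 ^ s ∸ 1)) ≡ 2 ^ (j * s) * mod2^ (div2^ x (j * s)) s
  digit-j j j<r = trans (cong (λ z → andBits z x (2 ^ (j * s) * (2 ^ s ∸ 1))) (sym width))
                        (andBits-field (j * s) s (K0 ∸ (j * s + s)) x)
    where
    js+s≤K0 : j * s + s ≤ K0
    js+s≤K0 = ≤-trans (≤-reflexive (+-comm (j * s) s)) (≤-trans (*-monoˡ-≤ s j<r) rs≤K0)
    width : j * s + (s + (K0 ∸ (j * s + s))) ≡ K0
    width = trans (sym (+-assoc (j * s) s _)) (m+[n∸m]≡n js+s≤K0)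

[m+n%d]%d≡[m+n]%d : ∀ m n d .{{_ : NonZero d}} → (m + n % d) % d ≡ (m + n) % d
[m+n%d]%d≡[m+n]%d m n d = begin
    (m + n % d) % d          ≡⟨ %-distribˡ-+ m (n % d) d ⟩
    (m % d + n % d % d) % d  ≡⟨ cong (λ z → (m % d + z) % d) (m%n%n≡m%n n d) ⟩
    (m % d + n % d) % d      ≡⟨ sym (%-distribˡ-+ m n d) ⟩
    (m + n) % d              ∎
  where open ≡-Reasoning

x+[d∸y]≡x∸y+d : ∀ {d x y} → y ≤ x → y ≤ d → x + (d ∸ y) ≡ x ∸ y + d
x+[d∸y]≡x∸y+d {d} {x} {y} y≤x y≤d = begin
    x + (d ∸ y)          ≡⟨ cong (_+ (d ∸ y)) (sym (m∸n+n≡m y≤x)) ⟩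
    x ∸ y + y + (d ∸ y)  ≡⟨ +-assoc (x ∸ y) y (d ∸ y) ⟩
    x ∸ y + (y + (d ∸ y)) ≡⟨ cong (x ∸ y +_) (m+[n∸m]≡n y≤d) ⟩
    x ∸ y + d            ∎
  where open ≡-Reasoning

[x+[d∸y]]%d≡x∸y : ∀ {d x y} .{{_ : NonZero d}} → y ≤ x → x < d → (x + (d ∸ y)) % d ≡ x ∸ y
[x+[d∸y]]%d≡x∸y {d} {x} {y} y≤x x<d = begin
    (x + (d ∸ y)) % d  ≡⟨ cong (_% d) (x+[d∸y]≡x∸y+d y≤x (≤-trans y≤x (<⇒≤ x<d))) ⟩
    (x ∸ y + d) % d    ≡⟨ [m+n]%n≡m%n (x ∸ y) d ⟩
    (x ∸ y) % d        ≡⟨ m<n⇒m%n≡m (≤-<-trans (m∸n≤m x y) x<d) ⟩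
    x ∸ y              ∎
  where open ≡-Reasoning

d∸1∸y+1≡d∸y : ∀ {d y} → y < d → d ∸ 1 ∸ y + 1 ≡ d ∸ y
d∸1∸y+1≡d∸y {d} {y} y<d = begin
    d ∸ 1 ∸ y + 1    ≡⟨ cong (_+ 1) (∸-+-assoc d 1 y) ⟩
    d ∸ suc y + 1    ≡⟨ sym (+-∸-comm 1 y<d) ⟩
    d + 1 ∸ suc y    ≡⟨ cong (_∸ suc y) (+-comm d 1) ⟩
    1 + d ∸ (1 + y)  ≡⟨ [m+n]∸[m+o]≡n∸o 1 d y ⟩
    d ∸ y            ∎
  where open ≡-Reasoning

-- Subtraction is expressed through the complement: 𝒩 y ⊕ 1 denotes the additive inverse of y.
_⊖_ : Term → Term → Term
x ⊖ y = x ⊕ (𝒩 y ⊕ c1)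

-- With K = eval X and R = eval r, this denotes (2^(K R) − 1) / (2^K − 1) = repunit K R.
repunitT : Term → Term → Term
repunitT X r = (𝐩 (X ⊗ r) ⊕ cm1) ⊘ (𝐩 X ⊕ cm1)

nOf<size : ∀ v → nOf v < size v
nOf<size v = n<2^n (nOf v)

module Eval (v : ℕ) (ρ : Env) where
  N Z : ℕ
  N = nOf v
  Z = size v

  instance size≢0 = m^n≢0 2 N

  eval-⊕ : ∀ s r x y → eval v ρ s ≡ x → eval v ρ r ≡ y → x + y < Z → eval v ρ (s ⊕ r) ≡ x + y
  eval-⊕ s r x y ex ey lt = trans (cong₂ (λ a b → (a + b) % Z) ex ey) (m<n⇒m%n≡m lt)

  eval-⊗ : ∀ s r x y → eval v ρ s ≡ x → eval v ρ r ≡ y → x * y < Z → eval v ρ (s ⊗ r) ≡ x * y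
  eval-⊗ s r x y ex ey lt = trans (cong₂ (λ a b → (a * b) % Z) ex ey) (m<n⇒m%n≡m lt)

  eval-⊘ : ∀ s r x y .{{_ : NonZero y}} → eval v ρ s ≡ x → eval v ρ r ≡ y → eval v ρ (s ⊘ r) ≡ x / y
  eval-⊘ s r x y ex ey = trans (cong₂ divZ ex ey) (divZ≡/ x y)

  eval-∩ : ∀ s r x y → eval v ρ s ≡ x → eval v ρ r ≡ y → eval v ρ (s ∩ r) ≡ andBits N x y
  eval-∩ s r x y ex ey = cong₂ (andBits N) ex ey

  eval-𝐩 : ∀ s x → eval v ρ s ≡ x → x < N → eval v ρ (𝐩 s) ≡ 2 ^ x
  eval-𝐩 s x ex x<N = trans (cong (λ a → 2 ^ a ⊓ (Z ∸ 1)) ex)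
    (m≤n⇒m⊓n≡m (m+n≤o⇒m≤o∸n (2 ^ x) (subst (_≤ Z) (+-comm 1 (2 ^ x)) (2^-monoʳ-< x N x<N))))

  eval-pred : ∀ s x → eval v ρ s ≡ x → 1 ≤ x → x < Z → eval v ρ (s ⊕ cm1) ≡ x ∸ 1
  eval-pred s x ex 1≤x x<Z = trans (cong (λ a → mod2^ (a + (Z ∸ 1)) N) ex) ([x+[d∸y]]%d≡x∸y 1≤x x<Z)

  eval-⊖ : ∀ s r x y → eval v ρ s ≡ x → eval v ρ r ≡ y → y ≤ x → x < Z → eval v ρ (s ⊖ r) ≡ x ∸ y
  eval-⊖ s r x y ex ey y≤x x<Z = begin
      eval v ρ (s ⊖ r)                 ≡⟨ cong₂ (λ a b → (a + (Z ∸ 1 ∸ b + 1) % Z) % Z) ex ey ⟩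
      (x + (Z ∸ 1 ∸ y + 1) % Z) % Z    ≡⟨ cong (λ z → (x + z % Z) % Z) (d∸1∸y+1≡d∸y (≤-<-trans y≤x x<Z)) ⟩
      (x + (Z ∸ y) % Z) % Z            ≡⟨ [m+n%d]%d≡[m+n]%d x (Z ∸ y) Z ⟩
      (x + (Z ∸ y)) % Z                ≡⟨ [x+[d∸y]]%d≡x∸y y≤x x<Z ⟩
      x ∸ y                            ∎
    where open ≡-Reasoning

  eval-repunitT : ∀ X r K R → eval v ρ X ≡ K → eval v ρ r ≡ R → 1 ≤ K → K * R < N → K < N →
                  eval v ρ (repunitT X r) ≡ repunit K R
  eval-repunitT X r K R eX eR 1≤K KR<N K<N =
    trans (eval-⊘ (𝐩 (X ⊗ r) ⊕ cm1) (𝐩 X ⊕ cm1) _ _ {{2^K∸1≢0}} (eval-pred (𝐩 (X ⊗ r)) _ 2^KR (2^>0 (K * R)) (2^-monoʳ-< (K * R) N KR<N))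
                               (eval-pred (𝐩 X) _ 2^K (2^>0 K) (2^-monoʳ-< K N K<N)))
          quotient
    where
    2^K∸1≢0 : NonZero (2 ^ K ∸ 1)
    2^K∸1≢0 = >-nonZero (∸-monoˡ-< {1} {1} {2 ^ K} (2^-monoʳ-≤ 1 K 1≤K) ≤-refl)
    2^KR : eval v ρ (𝐩 (X ⊗ r)) ≡ 2 ^ (K * R)
    2^KR = eval-𝐩 (X ⊗ r) _ (eval-⊗ X r _ _ eX eR (<-trans KR<N (nOf<size v))) KR<N
    2^K : eval v ρ (𝐩 X) ≡ 2 ^ K
    2^K = eval-𝐩 X _ eX K<N
    quotient : _/_ (2 ^ (K * R) ∸ 1) (2 ^ K ∸ 1) {{2^K∸1≢0}} ≡ repunit K R
    quotient = trans (cong (λ z → _/_ (z ∸ 1) (2 ^ K ∸ 1) {{2^K∸1≢0}}) (sym (repunit-geometric K R)))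
                 (trans (cong (λ z → _/_ z (2 ^ K ∸ 1) {{2^K∸1≢0}}) (m+n∸n≡m _ 1)) (m*n/n≡m _ (2 ^ K ∸ 1) {{2^K∸1≢0}}))

thresholdBit : ℕ → ℕ → ℕ → ℕ
thresholdBit p c y = mod2^ (div2^ (y + (2 ^ p ∸ c)) p) 1

thresholdBit-< : ∀ p c y → c ≤ 2 ^ p → y < c → thresholdBit p c y ≡ 0
thresholdBit-< p c y c≤2^p y<c =
  x/2^p%2≡0 p _ (subst (y + (2 ^ p ∸ c) <_) (m+[n∸m]≡n c≤2^p) (+-monoˡ-< (2 ^ p ∸ c) y<c))

thresholdBit-≥ : ∀ p c y → c ≤ 2 ^ p → c ≤ y → y < 2 ^ p → thresholdBit p c y ≡ 1
thresholdBit-≥ p c y c≤2^p c≤y y<2^p = x/2^p%2≡1 p _ lo hi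
  where
  lo : 2 ^ p ≤ y + (2 ^ p ∸ c)
  lo = subst (_≤ y + (2 ^ p ∸ c)) (m+[n∸m]≡n c≤2^p) (+-monoˡ-≤ (2 ^ p ∸ c) c≤y)
  hi : y + (2 ^ p ∸ c) < 2 ^ suc p
  hi = subst (y + (2 ^ p ∸ c) <_) (sym (2^[1+p]≡2^p+2^p p)) (+-mono-<-≤ y<2^p (m∸n≤m (2 ^ p) c))

-- The test performed in one diagonal block of the main construction, whose digits have s bits.
-- For a product P of two digits and a digit W of w, the block holds overflow P + W, and the
-- condition of R56 at that block says exactly that this sum is not 1.
module BlockTest (s : ℕ) where
  S g : ℕ
  S = 2 ^ s
  g = suc s

  overflow : ℕ → ℕ
  overflow P = thresholdBit (s + s) S P

  S≤2^[s+s] : S ≤ 2 ^ (s + s)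
  S≤2^[s+s] = 2^-monoʳ-≤ s (s + s) (m≤m+n s s)

  overflow-< : ∀ P → P < S → overflow P ≡ 0
  overflow-< P P<S = thresholdBit-< (s + s) S P S≤2^[s+s] P<S

  overflow-≥ : ∀ P → P < 2 ^ (s + s) → S ≤ P → overflow P ≡ 1
  overflow-≥ P P< S≤P = thresholdBit-≥ (s + s) S P S≤2^[s+s] S≤P P<

  overflow≤1 : ∀ P → overflow P ≤ 1
  overflow≤1 P = ≤-pred (m%n<n (div2^ (P + (2 ^ (s + s) ∸ S)) (s + s)) 2)

  atLeastTwo : ℕ → ℕ
  atLeastTwo y = thresholdBit g 2 y

  2≤2^g : 2 ≤ 2 ^ g
  2≤2^g = 2^-monoʳ-≤ 1 g (s≤s z≤n)

  S<2^g : S < 2 ^ g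
  S<2^g = 2^-monoʳ-< s g ≤-refl

  -- For y ≤ S this is 1 exactly when y ≠ 1: the subtrahend y is compensated by 2^g when y ≥ 2.
  notOne : ℕ → ℕ
  notOne y = mod2^ (div2^ (2 ^ g * atLeastTwo y + 2 ^ suc g ∸ y) (suc g)) 1

  notOne-0 : notOne 0 ≡ 1
  notOne-0 = begin
      notOne 0
    ≡⟨ cong (λ h → mod2^ (div2^ (2 ^ g * h + 2 ^ suc g) (suc g)) 1) (thresholdBit-< g 2 0 2≤2^g (s≤s z≤n)) ⟩
      mod2^ (div2^ (2 ^ g * 0 + 2 ^ suc g) (suc g)) 1
    ≡⟨ cong (λ z → mod2^ (div2^ (z + 2 ^ suc g) (suc g)) 1) (*-zeroʳ (2 ^ g)) ⟩
      mod2^ (div2^ (2 ^ suc g) (suc g)) 1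
    ≡⟨ x/2^p%2≡1 (suc g) (2 ^ suc g) ≤-refl (2^-monoʳ-< (suc g) (suc (suc g)) ≤-refl) ⟩
      1
    ∎
    where open ≡-Reasoning

  notOne-1 : notOne 1 ≡ 0
  notOne-1 = begin
      notOne 1
    ≡⟨ cong (λ h → mod2^ (div2^ (2 ^ g * h + 2 ^ suc g ∸ 1) (suc g)) 1) (thresholdBit-< g 2 1 2≤2^g (s≤s (s≤s z≤n))) ⟩
      mod2^ (div2^ (2 ^ g * 0 + 2 ^ suc g ∸ 1) (suc g)) 1
    ≡⟨ cong (λ z → mod2^ (div2^ (z + 2 ^ suc g ∸ 1) (suc g)) 1) (*-zeroʳ (2 ^ g)) ⟩
      mod2^ (div2^ (2 ^ suc g ∸ 1) (suc g)) 1
    ≡⟨ x/2^p%2≡0 (suc g) _ (∸-monoʳ-< {2 ^ suc g} {1} {0} (s≤s z≤n) (2^>0 (suc g))) ⟩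
      0
    ∎
    where open ≡-Reasoning

  notOne-≥2 : ∀ y → 2 ≤ y → y ≤ S → notOne y ≡ 1
  notOne-≥2 y 2≤y y≤S = begin
      notOne y
    ≡⟨ cong (λ h → mod2^ (div2^ (2 ^ g * h + 2 ^ suc g ∸ y) (suc g)) 1) (thresholdBit-≥ g 2 y 2≤2^g 2≤y y<2^g) ⟩
      mod2^ (div2^ (2 ^ g * 1 + 2 ^ suc g ∸ y) (suc g)) 1
    ≡⟨ cong (λ z → mod2^ (div2^ (z + 2 ^ suc g ∸ y) (suc g)) 1) (*-identityʳ (2 ^ g)) ⟩
      mod2^ (div2^ (2 ^ g + 2 ^ suc g ∸ y) (suc g)) 1
    ≡⟨ x/2^p%2≡1 (suc g) _ lo hi ⟩
      1
    ∎
    where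
    open ≡-Reasoning
    y<2^g : y < 2 ^ g
    y<2^g = ≤-<-trans y≤S S<2^g
    rearranged : 2 ^ g + 2 ^ suc g ∸ y ≡ (2 ^ g ∸ y) + 2 ^ suc g
    rearranged = trans (+-∸-comm (2 ^ suc g) (<⇒≤ y<2^g)) refl
    lo : 2 ^ suc g ≤ 2 ^ g + 2 ^ suc g ∸ y
    lo = subst (2 ^ suc g ≤_) (sym rearranged) (m≤n+m (2 ^ suc g) (2 ^ g ∸ y))
    hi : 2 ^ g + 2 ^ suc g ∸ y < 2 ^ suc (suc g)
    hi = ≤-<-trans (m∸n≤m _ y) (subst (2 ^ g + 2 ^ suc g <_) (sym (2^[1+p]≡2^p+2^p (suc g)))
                                  (+-monoˡ-< (2 ^ suc g) (2^-monoʳ-< g (suc g) ≤-refl)))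

  Matches : ℕ → ℕ → Set
  Matches P W = (W ≡ 0 → P < S) × (W ≡ 1 → P ≥ S)

  overflow+W≤S : ∀ P W → W < S → overflow P + W ≤ S
  overflow+W≤S P W W<S = subst (overflow P + W ≤_) (m+[n∸m]≡n (2^>0 s)) (+-mono-≤ (overflow≤1 P) (∸-monoˡ-≤ 1 W<S))

  Matches⇒notOne : ∀ P W → P < 2 ^ (s + s) → W < S → Matches P W → notOne (overflow P + W) ≡ 1
  Matches⇒notOne P zero P< W<S (below , _) =
    trans (cong notOne (trans (+-identityʳ _) (overflow-< P (below refl)))) notOne-0
  Matches⇒notOne P (suc zero) P< W<S (_ , above) =
    notOne-≥2 _ (≤-reflexive (cong (_+ 1) (sym (overflow-≥ P P< (above refl))))) (overflow+W≤S P 1 W<S)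
  Matches⇒notOne P W@(suc (suc _)) P< W<S _ =
    notOne-≥2 _ (≤-trans (s≤s (s≤s z≤n)) (m≤n+m W (overflow P))) (overflow+W≤S P W W<S)

  notOne⇒Matches : ∀ P W → P < 2 ^ (s + s) → notOne (overflow P + W) ≡ 1 → Matches P W
  notOne⇒Matches P W P< one = belowIfZero , aboveIfOne
    where
    sum≢1 : overflow P + W ≡ 1 → ⊥
    sum≢1 eq = 0≢1+n (trans (sym notOne-1) (trans (cong notOne (sym eq)) one))
    belowIfZero : W ≡ 0 → P < S
    belowIfZero refl with P <? S
    ... | yes P<S = P<S
    ... | no P≮S = ⊥-elim (sum≢1 (trans (+-identityʳ _) (overflow-≥ P P< (≮⇒≥ P≮S))))
    aboveIfOne : W ≡ 1 → P ≥ S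
    aboveIfOne refl with P <? S
    ... | no P≮S = ≮⇒≥ P≮S
    ... | yes P<S = ⊥-elim (sum≢1 (cong (_+ 1) (overflow-< P P<S)))

-- The bound behind the constant c = 8: the widest intermediate value of the construction has
-- D (m² + m) + s + 2 bits (D = 2 s m + s), which is at most 2^(4 + t + 3e) ≤ 2^(8e + t).
width≤16sm³ : ∀ s m → 1 ≤ s → 2 ≤ m → (s * m + s * m + s) * (m * suc m) + s + 2 ≤ 16 * s * (m * (m * m))
width≤16sm³ (suc a) (suc zero) _ (s≤s ())
width≤16sm³ (suc a) (suc (suc b)) _ _ = ≤-trans (m≤m+n _ _) (≤-reflexive (sym (expand a b)))
  where
  expand : ∀ a b → 16 * suc a * (suc (suc b) * (suc (suc b) * suc (suc b))) ≡
     (suc a * suc (suc b) + suc a * suc (suc b) + suc a) * (suc (suc b) * suc (suc (suc b))) + suc a + 2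
     + (95 + 155 * b + 81 * (b * b) + 14 * (b * b * b) + a * (97 + 155 * b + 81 * (b * b) + 14 * (b * b * b)))
  expand = solve-∀

s+s+3≤2sm+s : ∀ s m → 1 ≤ s → 2 ≤ m → s + s + 3 ≤ s * m + s * m + s
s+s+3≤2sm+s (suc a) (suc zero) _ (s≤s ())
s+s+3≤2sm+s (suc a) (suc (suc b)) _ _ = ≤-trans (m≤m+n _ _) (≤-reflexive (sym (expand a b)))
  where
  expand : ∀ a b → suc a * suc (suc b) + suc a * suc (suc b) + suc a ≡ suc a + suc a + 3 + (2 * a * b + 3 * a + 2 * b)
  expand = solve-∀

4+t+3e≤8e+t : ∀ e t → 1 ≤ e → 4 + (t + (e + (e + e))) ≤ 8 * e + t
4+t+3e≤8e+t (suc e) t _ = ≤-trans (m≤m+n _ _) (≤-reflexive (sym (expand e t)))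
  where
  expand : ∀ e t → 8 * suc e + t ≡ 4 + (t + (suc e + (suc e + suc e))) + (1 + 5 * e)
  expand = solve-∀

-- Writing s = 2^t, n = 2^u = s m, S = 2^s, the digits of a, b, w are
-- spread into blocks of width D = 2n + s: A holds a's digits at blocks 0,…,m−1, B holds b's
-- digits at blocks 0, m, 2m, …, and W holds w's digits on the diagonal blocks i (m + 1) of
-- A B, which carry the products a[i] b[i]; Δ marks the diagonal blocks.
tT uT sT nT ST mT Sm1T KT DT DmT LT : Term
tT = var 4
uT = var 3
sT = 𝐩 tT
nT = 𝐩 uT
ST = 𝐩 sT
mT = nT ⊘ sT
Sm1T = ST ⊕ cm1
KT = nT ⊕ nT
DT = KT ⊕ sT
DmT = DT ⊗ mT
LT = DT ⊗ (mT ⊕ c1)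

spreadT : Term → Term → Term → Term
spreadT x K0 K1 = (x ⊗ repunitT K0 mT) ∩ (Sm1T ⊗ repunitT K1 mT)

-- Blockwise on the diagonal: X adds 2^(2s) − S so that bit 2s flags a[i] b[i] ≥ S, F extracts
-- that flag, U = F + W, and φ2 ≈ G says that every diagonal block of U differs from 1
-- (see BlockTest: H holds the flags U ≥ 2, and bit g+1 of H + G − U is then U ≠ 1).
AT BT WT ΔT T2T gT XT FT UT HT GT φ2 : Term
AT = spreadT (var 0) KT DT
BT = spreadT (var 1) (DmT ⊖ sT) DmT
WT = spreadT (var 2) (LT ⊖ sT) LT
ΔT = repunitT LT mT
T2T = 𝐩 (sT ⊕ sT)
gT = sT ⊕ c1
XT = (AT ⊗ BT) ⊕ ((T2T ⊖ ST) ⊗ ΔT)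
FT = (XT ∩ (T2T ⊗ ΔT)) ⊘ T2T
UT = FT ⊕ WT
HT = (UT ⊕ ((𝐩 gT ⊖ (c1 ⊕ c1)) ⊗ ΔT)) ∩ (𝐩 gT ⊗ ΔT)
GT = 𝐩 (gT ⊕ c1) ⊗ ΔT
φ2 = ((HT ⊕ GT) ⊖ UT) ∩ GT

module Blockwise (v u t a b w : ℕ) (t<u : t < u) (large : 8 * (u ∸ t) + t ≤ v)
           (a<2^2^u : a < 2 ^ (2 ^ u)) (b<2^2^u : b < 2 ^ (2 ^ u)) (w<2^2^u : w < 2 ^ (2 ^ u)) where
  e s m n S K D blockCount totalWidth L : ℕ
  e = u ∸ t
  s = 2 ^ t
  m = 2 ^ e
  n = s * m
  S = 2 ^ s
  K = n + n
  D = K + s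
  blockCount = m * suc m
  totalWidth = D * blockCount
  L = D * suc m

  ρ : Env
  ρ = envOf (a ∷ b ∷ w ∷ []) u t
  open Eval v ρ

  instance
    _ = m^n≢0 2 t
    _ = m^n≢0 2 e

  t+e≡u : t + e ≡ u
  t+e≡u = m+[n∸m]≡n (<⇒≤ t<u)

  2^u≡n : 2 ^ u ≡ n
  2^u≡n = trans (cong (2 ^_) (sym t+e≡u)) (^-distribˡ-+-* 2 t e)

  a< : a < 2 ^ n
  a< = subst (λ z → a < 2 ^ z) 2^u≡n a<2^2^u
  b< : b < 2 ^ n
  b< = subst (λ z → b < 2 ^ z) 2^u≡n b<2^2^u
  w< : w < 2 ^ n
  w< = subst (λ z → w < 2 ^ z) 2^u≡n w<2^2^u

  1≤e : 1 ≤ e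
  1≤e = m<n⇒0<n∸m t<u

  2≤m : 2 ≤ m
  2≤m = 2^-monoʳ-≤ 1 e 1≤e

  1≤s : 1 ≤ s
  1≤s = 2^>0 t

  16sm³≡2^[4+t+3e] : 16 * s * (m * (m * m)) ≡ 2 ^ (4 + (t + (e + (e + e))))
  16sm³≡2^[4+t+3e] = sym (trans (^-distribˡ-+-* 2 4 (t + (e + (e + e)))) (trans (cong (16 *_) (trans (^-distribˡ-+-* 2 t (e + (e + e)))
         (cong (s *_) (trans (^-distribˡ-+-* 2 e (e + e)) (cong (m *_) (^-distribˡ-+-* 2 e e)))))) (sym (*-assoc 16 s (m * (m * m))))))

  totalWidth+s+2≤N : totalWidth + s + 2 ≤ N
  totalWidth+s+2≤N = begin
      (s * m + s * m + s) * (m * suc m) + s + 2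
    ≤⟨ width≤16sm³ s m 1≤s 2≤m ⟩
      16 * s * (m * (m * m))
    ≡⟨ 16sm³≡2^[4+t+3e] ⟩
      2 ^ (4 + (t + (e + (e + e))))
    ≤⟨ 2^-monoʳ-≤ _ _ (≤-trans (4+t+3e≤8e+t e t 1≤e) large) ⟩
      N
    ∎
    where open ≤-Reasoning

  totalWidth<N : totalWidth < N
  totalWidth<N = <-≤-trans (≤-<-trans (m≤m+n totalWidth s) (m<m+n (totalWidth + s) (s≤s z≤n))) totalWidth+s+2≤N

  ≤totalWidth⇒<N : ∀ x → x ≤ totalWidth → x < N
  ≤totalWidth⇒<N x le = ≤-<-trans le totalWidth<N

  <2^≤totalWidth⇒<Z : ∀ x k → x < 2 ^ k → k ≤ totalWidth + s → x < Z
  <2^≤totalWidth⇒<Z x k lt le = <-≤-trans lt (2^-monoʳ-≤ k N (≤-trans le (≤-trans (m≤m+n (totalWidth + s) 2) totalWidth+s+2≤N)))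

  ≤totalWidth⇒<Z : ∀ x → x ≤ totalWidth → x < Z
  ≤totalWidth⇒<Z x le = <-trans (≤totalWidth⇒<N x le) (nOf<size v)

  t≤v : t ≤ v
  t≤v = ≤-trans (m≤n+m t (8 * e)) large

  u≤v : u ≤ v
  u≤v = subst (_≤ v) (trans (+-comm e t) t+e≡u) (≤-trans (+-monoˡ-≤ t (m≤n*m e 8)) large)

  eval-sT : eval v ρ sT ≡ s
  eval-sT = eval-𝐩 tT t refl (≤-<-trans t≤v (n<2^n v))

  eval-nT : eval v ρ nT ≡ n
  eval-nT = trans (eval-𝐩 uT u refl (≤-<-trans u≤v (n<2^n v))) 2^u≡n

  instance
    _ = m*n≢0 m (suc m)

  s≤D : s ≤ D
  s≤D = m≤n+m s K
  n≤K : n ≤ K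
  n≤K = m≤m+n n n
  K≤D : K ≤ D
  K≤D = m≤m+n K s
  D≤totalWidth : D ≤ totalWidth
  D≤totalWidth = m≤m*n D blockCount
  m≤blockCount : m ≤ blockCount
  m≤blockCount = m≤m*n m (suc m)
  1+m≤blockCount : suc m ≤ blockCount
  1+m≤blockCount = m≤n*m (suc m) m
  Dm≤totalWidth : D * m ≤ totalWidth
  Dm≤totalWidth = *-monoʳ-≤ D m≤blockCount
  L≤totalWidth : L ≤ totalWidth
  L≤totalWidth = *-monoʳ-≤ D 1+m≤blockCount
  s<N : s < N
  s<N = ≤totalWidth⇒<N s (≤-trans s≤D D≤totalWidth)
  Lm≡totalWidth : L * m ≡ totalWidth
  Lm≡totalWidth = trans (*-assoc D (suc m) m) (cong (D *_) (*-comm (suc m) m))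
  Dmm≤totalWidth : D * m * m ≤ totalWidth
  Dmm≤totalWidth = subst (_≤ totalWidth) (sym (*-assoc D m m)) (*-monoʳ-≤ D (*-monoʳ-≤ m (n≤1+n m)))
  Dm+Dmm≡totalWidth : D * m + D * m * m ≡ totalWidth
  Dm+Dmm≡totalWidth = trans (cong (D * m +_) (*-assoc D m m)) (trans (sym (*-distribˡ-+ D m (m * m))) (cong (D *_) (sym (*-suc m m))))

  eval-ST : eval v ρ ST ≡ S
  eval-ST = eval-𝐩 sT s eval-sT s<N

  eval-mT : eval v ρ mT ≡ m
  eval-mT = trans (eval-⊘ nT sT n s eval-nT eval-sT) (trans (cong (_/ s) (*-comm s m)) (m*n/n≡m m s))

  eval-Sm1T : eval v ρ Sm1T ≡ S ∸ 1
  eval-Sm1T = eval-pred ST S eval-ST (2^>0 s) (2^-monoʳ-< s N s<N)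

  eval-KT : eval v ρ KT ≡ K
  eval-KT = eval-⊕ nT nT n n eval-nT eval-nT (≤totalWidth⇒<Z K (≤-trans K≤D D≤totalWidth))

  eval-DT : eval v ρ DT ≡ D
  eval-DT = eval-⊕ KT sT K s eval-KT eval-sT (≤totalWidth⇒<Z D D≤totalWidth)

  eval-DmT : eval v ρ DmT ≡ D * m
  eval-DmT = eval-⊗ DT mT D m eval-DT eval-mT (≤totalWidth⇒<Z (D * m) Dm≤totalWidth)

  eval-LT : eval v ρ LT ≡ L
  eval-LT = trans (eval-⊗ DT (mT ⊕ c1) D (m + 1) eval-DT (eval-⊕ mT c1 m 1 eval-mT refl (≤totalWidth⇒<Z (m + 1) (≤-trans (≤-reflexive (+-comm m 1)) (≤-trans 1+m≤blockCount (m≤n*m blockCount D {{nzD}})))))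
           (≤totalWidth⇒<Z (D * (m + 1)) (≤-trans (≤-reflexive (cong (D *_) (+-comm m 1))) L≤totalWidth)))
         (cong (D *_) (+-comm m 1))
    where
    nzD : NonZero D
    nzD = >-nonZero (≤-trans 1≤s s≤D)

  repunit-bounded : ∀ K0 → 1 ≤ K0 → Bounded K0 (λ _ → 1) m
  repunit-bounded K0 le _ _ = 2^-monoʳ-≤ 1 K0 le

  S∸1<S : S ∸ 1 < 2 ^ s
  S∸1<S = ∸-monoʳ-< {S} {1} {0} (s≤s z≤n) (2^>0 s)

  eval-spreadT : ∀ xT x K0T K1T K0 K1 → eval v ρ xT ≡ x → x < 2 ^ n → eval v ρ K0T ≡ K0 → eval v ρ K1T ≡ K1 →
          K0 + s ≡ K1 → n ≤ K0 → 1 ≤ K0 → K1 * m ≤ totalWidth → n + K0 * m ≤ totalWidth →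
          eval v ρ (spreadT xT K0T K1T) ≡ blocks K1 (λ j → mod2^ (div2^ x (j * s)) s) m
  eval-spreadT xT x K0T K1T K0 .(K0 + s) ex x< eK0 eK1 refl n≤ 1≤K0 K1m≤ nK0m≤ =
    trans (eval-∩ (xT ⊗ repunitT K0T mT) (Sm1T ⊗ repunitT K1T mT) _ _ copies masks) (andBits-spread s N K0 x m (<-≤-trans x< (2^-monoʳ-≤ n K0 n≤)) (≤-trans (≤-reflexive (*-comm m s)) n≤) (<⇒≤ (≤totalWidth⇒<N _ K0m≤)))
    where
    K1 : ℕ
    K1 = K0 + s
    K0m≤ : K0 * m ≤ totalWidth
    K0m≤ = ≤-trans (m≤n+m (K0 * m) n) nK0m≤
    1≤K1 : 1 ≤ K1
    1≤K1 = ≤-trans 1≤K0 (m≤m+n K0 s)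
    K0<N : K0 < N
    K0<N = ≤totalWidth⇒<N K0 (≤-trans (m≤m*n K0 m) K0m≤)
    K1<N : K1 < N
    K1<N = ≤totalWidth⇒<N K1 (≤-trans (m≤m*n K1 m) K1m≤)
    copiesRepunit : eval v ρ (repunitT K0T mT) ≡ repunit K0 m
    copiesRepunit = eval-repunitT K0T mT K0 m eK0 eval-mT 1≤K0 (≤totalWidth⇒<N _ K0m≤) K0<N
    copies : eval v ρ (xT ⊗ repunitT K0T mT) ≡ x * repunit K0 m
    copies = eval-⊗ xT (repunitT K0T mT) x (repunit K0 m) ex copiesRepunit
           (<2^≤totalWidth⇒<Z _ (n + K0 * m) (x*y<2^[p+q] x _ n (K0 * m) x< (blocks-< K0 _ m (repunit-bounded K0 1≤K0))) (≤-trans nK0m≤ (m≤m+n totalWidth s)))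
    masksRepunit : eval v ρ (repunitT K1T mT) ≡ repunit K1 m
    masksRepunit = eval-repunitT K1T mT K1 m eK1 eval-mT 1≤K1 (≤totalWidth⇒<N _ K1m≤) K1<N
    masks : eval v ρ (Sm1T ⊗ repunitT K1T mT) ≡ (S ∸ 1) * repunit K1 m
    masks = eval-⊗ Sm1T (repunitT K1T mT) (S ∸ 1) (repunit K1 m) eval-Sm1T masksRepunit
           (<2^≤totalWidth⇒<Z _ (s + K1 * m) (x*y<2^[p+q] (S ∸ 1) _ s (K1 * m) S∸1<S (blocks-< K1 _ m (repunit-bounded K1 1≤K1))) (≤-trans (≤-reflexive (+-comm s _)) (+-monoˡ-≤ s K1m≤)))

  aDigit bDigit wDigit : ℕ → ℕ
  aDigit j = mod2^ (div2^ a (j * s)) s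
  bDigit j = mod2^ (div2^ b (j * s)) s
  wDigit j = mod2^ (div2^ w (j * s)) s

  eval-AT : eval v ρ AT ≡ blocks D aDigit m
  eval-AT = eval-spreadT (var 0) a KT DT K D refl a< eval-KT eval-DT refl n≤K (≤-trans 1≤s (≤-trans (m≤m*n s m) n≤K)) Dm≤totalWidth nKm
    where
    nKm : n + K * m ≤ totalWidth
    nKm = ≤-trans (+-monoˡ-≤ (K * m) n≤K) (≤-trans (≤-reflexive (sym (*-suc K m))) (≤-trans (*-monoˡ-≤ (suc m) K≤D) L≤totalWidth))

  D≤Dm : D ≤ D * m
  D≤Dm = m≤m*n D m
  s≤Dm : s ≤ D * m
  s≤Dm = ≤-trans s≤D D≤Dm
  D∸s : D ∸ s ≡ K
  D∸s = m+n∸n≡m K s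
  1≤n : 1 ≤ n
  1≤n = ≤-trans 1≤s (m≤m*n s m)

  Kb : ℕ
  Kb = D * m ∸ s
  eval-BT : eval v ρ BT ≡ blocks (D * m) bDigit m
  eval-BT = eval-spreadT (var 1) b (DmT ⊖ sT) DmT Kb (D * m) refl b<
           (eval-⊖ DmT sT (D * m) s eval-DmT eval-sT s≤Dm (≤totalWidth⇒<Z _ Dm≤totalWidth)) eval-DmT
           (m∸n+n≡m s≤Dm) n≤Kb (≤-trans 1≤n n≤Kb) Dmm≤totalWidth nKm
    where
    n≤Kb : n ≤ Kb
    n≤Kb = ≤-trans n≤K (≤-trans (≤-reflexive (sym D∸s)) (∸-monoˡ-≤ s D≤Dm))
    nKm : n + Kb * m ≤ totalWidth
    nKm = ≤-trans (+-monoˡ-≤ (Kb * m) n≤Kb) (≤-trans (≤-reflexive (sym (*-suc Kb m)))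
            (≤-trans (*-monoˡ-≤ (suc m) (m∸n≤m (D * m) s)) (≤-reflexive (*-assoc D m (suc m)))))

  Kw : ℕ
  Kw = L ∸ s
  s≤L : s ≤ L
  s≤L = ≤-trans s≤D (m≤m*n D (suc m))
  eval-WT-spread : eval v ρ WT ≡ blocks L wDigit m
  eval-WT-spread = eval-spreadT (var 2) w (LT ⊖ sT) LT Kw L refl w<
           (eval-⊖ LT sT L s eval-LT eval-sT s≤L (≤totalWidth⇒<Z _ L≤totalWidth)) eval-LT
           (m∸n+n≡m s≤L) n≤Kw (≤-trans 1≤n n≤Kw) (≤-reflexive Lm≡totalWidth) (≤-reflexive nKm)
    where
    n≤Kw : n ≤ Kw
    n≤Kw = ≤-trans n≤K (≤-trans (≤-reflexive (sym D∸s)) (∸-monoˡ-≤ s (m≤m*n D (suc m))))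
    nKm : n + Kw * m ≡ totalWidth
    nKm = trans (sym (*-distribʳ-+ m s Kw)) (trans (cong (_* m) (m+[n∸m]≡n s≤L)) Lm≡totalWidth)

  eval-ΔT : eval v ρ ΔT ≡ repunit L m
  eval-ΔT = eval-repunitT LT mT L m eval-LT eval-mT (≤-trans 1≤s s≤L) (≤totalWidth⇒<N _ (≤-reflexive Lm≡totalWidth)) (≤totalWidth⇒<N L L≤totalWidth)

  digit<S : ∀ x j → mod2^ (div2^ x (j * s)) s < S
  digit<S x j = m%n<n (div2^ x (j * s)) S {{m^n≢0 2 s}}

  bDigit-m≡0 : bDigit m ≡ 0
  bDigit-m≡0 = trans (cong (λ z → _%_ z S {{m^n≢0 2 s}}) (m<n⇒m/n≡0 {{m^n≢0 2 (m * s)}} (subst (λ z → b < 2 ^ z) (*-comm s m) b<)))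
               (m<n⇒m%n≡m {{m^n≢0 2 s}} (2^>0 s))

  abBlock : ℕ → ℕ
  abBlock k = aDigit (k % m) * bDigit (k / m)

  A*B≡abBlocks : blocks D aDigit m * blocks (D * m) bDigit m ≡ blocks D abBlock blockCount
  A*B≡abBlocks = begin
      blocks D aDigit m * blocks (D * m) bDigit m
    ≡⟨ *-blocks (D * m) (blocks D aDigit m) bDigit m ⟩
      blocks (D * m) (λ j → blocks D aDigit m * bDigit j) m
    ≡⟨ blocks-cong (D * m) _ G m (λ j _ → trans (*-comm (blocks D aDigit m) (bDigit j)) (trans (*-blocks D (bDigit j) aDigit m) (blocks-cong D _ _ m (λ i _ → *-comm (bDigit j) (aDigit i))))) ⟩
      blocks (D * m) G m
    ≡⟨ sym (blocks-dropLast (D * m) G m (blocks-zero D _ m (λ i _ → trans (cong (aDigit i *_) bDigit-m≡0) (*-zeroʳ (aDigit i))))) ⟩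
      blocks (D * m) G (m + 1)
    ≡⟨ cong (blocks (D * m) G) (+-comm m 1) ⟩
      blocks (D * m) G (suc m)
    ≡⟨ blocks-cong (D * m) _ _ (suc m) (λ j _ → blocks-cong D _ _ m (λ i i< → sym (pf j i i<))) ⟩
      blocks (D * m) (λ j → blocks D (λ i → abBlock (j * m + i)) m) (suc m)
    ≡⟨ sym (blocks-chunks D abBlock (suc m) m) ⟩
      blocks D abBlock (suc m * m)
    ≡⟨ cong (blocks D abBlock) (*-comm (suc m) m) ⟩
      blocks D abBlock blockCount
    ∎
    where
    open ≡-Reasoning
    G : ℕ → ℕ
    G j = blocks D (λ i → aDigit i * bDigit j) m
    pf : ∀ j i → i < m → abBlock (j * m + i) ≡ aDigit i * bDigit j
    pf j i i< = cong₂ (λ x y → aDigit x * bDigit y) (trans (cong (_% m) (+-comm (j * m) i)) ([r+q*d]%d≡r j i m i<))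
                                             (trans (cong (_/ m) (+-comm (j * m) i)) ([r+q*d]/d≡q j i m i<))

  aDigit-bounded : Bounded D aDigit m
  aDigit-bounded j _ = <-≤-trans (digit<S a j) (2^-monoʳ-≤ s D s≤D)
  bDigit-bounded : Bounded (D * m) bDigit m
  bDigit-bounded j _ = <-≤-trans (digit<S b j) (2^-monoʳ-≤ s (D * m) s≤Dm)

  eval-AT⊗BT : eval v ρ (AT ⊗ BT) ≡ blocks D abBlock blockCount
  eval-AT⊗BT = trans (eval-⊗ AT BT _ _ eval-AT eval-BT (<2^≤totalWidth⇒<Z _ totalWidth (subst (λ z → blocks D aDigit m * blocks (D * m) bDigit m < 2 ^ z) Dm+Dmm≡totalWidth
             (x*y<2^[p+q] _ _ (D * m) (D * m * m) (blocks-< D aDigit m aDigit-bounded) (blocks-< (D * m) bDigit m bDigit-bounded))) (m≤m+n totalWidth s))) A*B≡abBlocks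

  δ : ℕ → ℕ
  δ k = isZero (k % suc m)

  δ-bit : ∀ k → Bit (δ k)
  δ-bit k = isZero-bit (k % suc m)

  *repunit-diagonal : ∀ c → c * repunit L m ≡ blocks D (λ k → c * δ k) blockCount
  *repunit-diagonal c = trans (*-blocks L c _ m) (trans (blocks-sparse D (λ _ → c * 1) m m)
               (blocks-cong D _ _ blockCount (λ k _ → trans (*-comm (δ k) (c * 1)) (cong (_* δ k) (*-identityʳ c)))))

  Wblock : ℕ → ℕ
  Wblock k = δ k * wDigit (k / suc m)

  eval-WT : eval v ρ WT ≡ blocks D Wblock blockCount
  eval-WT = trans eval-WT-spread (blocks-sparse D wDigit m m)

  T2 overflowOffset g twoOffset marker : ℕ
  T2 = 2 ^ (s + s)
  overflowOffset = T2 ∸ S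
  g = suc s
  twoOffset = 2 ^ g ∸ 2
  marker = 2 ^ suc g

  Xblock Fblock Ublock Hblock Gblock Rblock : ℕ → ℕ
  Xblock k = abBlock k + overflowOffset * δ k
  Fblock k = δ k * (div2^ (Xblock k) (s + s) % 2)
  Ublock k = Fblock k + Wblock k
  Hblock k = andBits D (Ublock k + twoOffset * δ k) (2 ^ g * δ k)
  Gblock k = marker * δ k
  Rblock k = andBits D (Hblock k + Gblock k ∸ Ublock k) (Gblock k)

  2s+3≤D : s + s + 3 ≤ D
  2s+3≤D = s+s+3≤2sm+s s m 1≤s 2≤m

  <2^D : ∀ x p → x < 2 ^ p → p ≤ D → x < 2 ^ D
  <2^D x p lt le = <-≤-trans lt (2^-monoʳ-≤ p D le)

  2s≤D : s + s ≤ D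
  2s≤D = ≤-trans (m≤m+n (s + s) 3) 2s+3≤D

  totalWidth≤N : D * blockCount ≤ N
  totalWidth≤N = <⇒≤ totalWidth<N

  eval-⊕-blocks : ∀ sT' rT f h → eval v ρ sT' ≡ blocks D f blockCount → eval v ρ rT ≡ blocks D h blockCount → Bounded D (λ k → f k + h k) blockCount →
            eval v ρ (sT' ⊕ rT) ≡ blocks D (λ k → f k + h k) blockCount
  eval-⊕-blocks sT' rT f h ef eh bnd = trans (eval-⊕ sT' rT _ _ ef eh (subst (_< Z) (sym eq) (<2^≤totalWidth⇒<Z _ totalWidth (blocks-< D _ blockCount bnd) (m≤m+n totalWidth s)))) eq
    where
    eq : blocks D f blockCount + blocks D h blockCount ≡ blocks D (λ k → f k + h k) blockCount
    eq = blocks-+ D f h blockCount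

  eval-∩-blocks : ∀ sT' rT f h → eval v ρ sT' ≡ blocks D f blockCount → eval v ρ rT ≡ blocks D h blockCount → Bounded D f blockCount → Bounded D h blockCount →
            eval v ρ (sT' ∩ rT) ≡ blocks D (λ k → andBits D (f k) (h k)) blockCount
  eval-∩-blocks sT' rT f h ef eh f-bounded h-bounded = trans (eval-∩ sT' rT _ _ ef eh) (andBits-blocks N D f h blockCount totalWidth≤N f-bounded h-bounded)

  eval-⊗ΔT : ∀ cT c → eval v ρ cT ≡ c → c < 2 ^ D → eval v ρ (cT ⊗ ΔT) ≡ blocks D (λ k → c * δ k) blockCount
  eval-⊗ΔT cT c ec c< = trans (eval-⊗ cT ΔT c _ ec eval-ΔT (subst (_< Z) (sym (*repunit-diagonal c)) (<2^≤totalWidth⇒<Z _ totalWidth (blocks-< D _ blockCount bnd) (m≤m+n totalWidth s)))) (*repunit-diagonal c)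
    where
    bnd : Bounded D (λ k → c * δ k) blockCount
    bnd k _ = ≤-<-trans (*bit≤ c (δ k) (δ-bit k)) c<

  2s<N : s + s < N
  2s<N = ≤totalWidth⇒<N _ (≤-trans 2s≤D D≤totalWidth)

  eval-T2T : eval v ρ T2T ≡ T2
  eval-T2T = eval-𝐩 (sT ⊕ sT) (s + s) (eval-⊕ sT sT s s eval-sT eval-sT (<-trans 2s<N (nOf<size v))) 2s<N

  S≤T2 : S ≤ T2
  S≤T2 = 2^-monoʳ-≤ s (s + s) (m≤m+n s s)

  T2<Z : T2 < Z
  T2<Z = 2^-monoʳ-< (s + s) N 2s<N

  T2<2^D : T2 < 2 ^ D
  T2<2^D = 2^-monoʳ-< (s + s) D (<-≤-trans (m<m+n (s + s) (s≤s z≤n)) 2s+3≤D)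

  eval-T2T⊖ST : eval v ρ (T2T ⊖ ST) ≡ overflowOffset
  eval-T2T⊖ST = eval-⊖ T2T ST T2 S eval-T2T eval-ST S≤T2 T2<Z

  abBlock<T2 : ∀ k → abBlock k < T2
  abBlock<T2 k = x*y<2^[p+q] _ _ s s (digit<S a (k % m)) (digit<S b (k / m))

  1+2s≤D : suc (s + s) ≤ D
  1+2s≤D = ≤-trans (≤-trans (≤-reflexive (+-comm 1 (s + s))) (+-monoʳ-≤ (s + s) (s≤s z≤n))) 2s+3≤D

  Xblock-bounded : Bounded D Xblock blockCount
  Xblock-bounded k _ = <2^D _ (suc (s + s)) (subst (Xblock k <_) (sym (2^[1+p]≡2^p+2^p (s + s))) (+-mono-<-≤ (abBlock<T2 k) (≤-trans (*bit≤ overflowOffset (δ k) (δ-bit k)) (m∸n≤m T2 S))))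
             1+2s≤D

  eval-XT : eval v ρ XT ≡ blocks D Xblock blockCount
  eval-XT = eval-⊕-blocks (AT ⊗ BT) ((T2T ⊖ ST) ⊗ ΔT) abBlock (λ k → overflowOffset * δ k) eval-AT⊗BT
           (eval-⊗ΔT (T2T ⊖ ST) overflowOffset eval-T2T⊖ST (≤-<-trans (m∸n≤m T2 S) T2<2^D)) Xblock-bounded

  instance _ = m^n≢0 2 (s + s)

  eval-FT : eval v ρ FT ≡ blocks D Fblock blockCount
  eval-FT = trans (eval-⊘ (XT ∩ (T2T ⊗ ΔT)) T2T _ T2 (trans masked masked≡T2*F) eval-T2T) (trans (cong (_/ T2) (*-comm T2 _)) (m*n/n≡m _ T2))
    where
    flagMasks : eval v ρ (T2T ⊗ ΔT) ≡ blocks D (λ k → T2 * δ k) blockCount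
    flagMasks = eval-⊗ΔT T2T T2 eval-T2T T2<2^D
    flagMasks-bounded : Bounded D (λ k → T2 * δ k) blockCount
    flagMasks-bounded k _ = ≤-<-trans (*bit≤ T2 (δ k) (δ-bit k)) T2<2^D
    masked : eval v ρ (XT ∩ (T2T ⊗ ΔT)) ≡ blocks D (λ k → andBits D (Xblock k) (T2 * δ k)) blockCount
    masked = eval-∩-blocks XT (T2T ⊗ ΔT) Xblock (λ k → T2 * δ k) eval-XT flagMasks Xblock-bounded flagMasks-bounded
    masked≡T2*F : blocks D (λ k → andBits D (Xblock k) (T2 * δ k)) blockCount ≡ T2 * blocks D Fblock blockCount
    masked≡T2*F = trans (blocks-cong D _ _ blockCount (λ k _ → andBits-bitMask D (s + s) (Xblock k) (δ k) (δ-bit k) 1+2s≤D)) (sym (*-blocks D T2 Fblock blockCount))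

  Fblock≤δ : ∀ k → Fblock k ≤ δ k
  Fblock≤δ k = ≤-trans (*-monoʳ-≤ (δ k) (≤-pred (m%n<n (div2^ (Xblock k) (s + s)) 2))) (≤-reflexive (*-identityʳ (δ k)))

  1+[S∸1]≡S : suc (S ∸ 1) ≡ S
  1+[S∸1]≡S = m+[n∸m]≡n {1} (2^>0 s)

  Ublock≤δS : ∀ k → Ublock k ≤ δ k * S
  Ublock≤δS k = ≤-trans (+-mono-≤ (Fblock≤δ k) (*-monoʳ-≤ (δ k) (≤-pred (subst (wDigit (k / suc m) <_) (sym 1+[S∸1]≡S) (digit<S w (k / suc m))))))
           (≤-reflexive (trans (sym (*-suc (δ k) (S ∸ 1))) (cong (δ k *_) 1+[S∸1]≡S)))

  S<2^g : S < 2 ^ g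
  S<2^g = 2^-monoʳ-< s g ≤-refl

  g+2≤D : suc (suc g) ≤ D
  g+2≤D = ≤-trans (≤-reflexive (+-comm 3 s)) (≤-trans (+-monoˡ-≤ 3 (m≤m+n s s)) 2s+3≤D)

  Ublock-bounded : Bounded D Ublock blockCount
  Ublock-bounded k _ = ≤-<-trans (Ublock≤δS k) (≤-<-trans (bit*≤ S (δ k) (δ-bit k)) (<2^D S g S<2^g (≤-trans (n≤1+n g) (≤-trans (n≤1+n (suc g)) g+2≤D))))

  eval-UT : eval v ρ UT ≡ blocks D Ublock blockCount
  eval-UT = eval-⊕-blocks FT WT Fblock Wblock eval-FT eval-WT Ublock-bounded

  g<N : g < N
  g<N = ≤totalWidth⇒<N g (≤-trans (≤-trans (n≤1+n g) (≤-trans (n≤1+n (suc g)) g+2≤D)) D≤totalWidth)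
  1+g<N : suc g < N
  1+g<N = ≤totalWidth⇒<N (suc g) (≤-trans (≤-trans (n≤1+n (suc g)) g+2≤D) D≤totalWidth)
  2≤2s+3 : 2 ≤ s + s + 3
  2≤2s+3 = ≤-trans (s≤s (s≤s z≤n)) (m≤n+m 3 (s + s))

  eval-gT : eval v ρ gT ≡ g
  eval-gT = trans (eval-⊕ sT c1 s 1 eval-sT refl (<-trans g'<N (nOf<size v))) (+-comm s 1)
    where
    g'<N : s + 1 < N
    g'<N = subst (_< N) (+-comm 1 s) g<N

  eval-𝐩gT : eval v ρ (𝐩 gT) ≡ 2 ^ g
  eval-𝐩gT = eval-𝐩 gT g eval-gT g<N

  eval-2 : eval v ρ (c1 ⊕ c1) ≡ 2
  eval-2 = eval-⊕ c1 c1 1 1 refl refl (≤totalWidth⇒<Z 2 (≤-trans 2≤2s+3 (≤-trans 2s+3≤D D≤totalWidth)))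

  2≤2^g : 2 ≤ 2 ^ g
  2≤2^g = 2^-monoʳ-≤ 1 g (s≤s z≤n)

  eval-𝐩gT⊖2 : eval v ρ ((𝐩 gT) ⊖ (c1 ⊕ c1)) ≡ twoOffset
  eval-𝐩gT⊖2 = eval-⊖ (𝐩 gT) (c1 ⊕ c1) (2 ^ g) 2 eval-𝐩gT eval-2 2≤2^g (2^-monoʳ-< g N g<N)

  2^g<2^D : 2 ^ g < 2 ^ D
  2^g<2^D = 2^-monoʳ-< g D (≤-trans (n≤1+n (suc g)) g+2≤D)
  marker<2^D : marker < 2 ^ D
  marker<2^D = 2^-monoʳ-< (suc g) D g+2≤D
  2^[1+g]≤2^D : 2 ^ suc g ≤ 2 ^ D
  2^[1+g]≤2^D = 2^-monoʳ-≤ (suc g) D (≤-trans (n≤1+n (suc g)) g+2≤D)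

  Utwoblock-bounded : Bounded D (λ k → Ublock k + twoOffset * δ k) blockCount
  Utwoblock-bounded k _ = <-≤-trans (subst (Ublock k + twoOffset * δ k <_) (sym (2^[1+p]≡2^p+2^p g))
                 (+-mono-<-≤ (≤-<-trans (Ublock≤δS k) (≤-<-trans (bit*≤ S (δ k) (δ-bit k)) S<2^g)) (≤-trans (*bit≤ twoOffset (δ k) (δ-bit k)) (m∸n≤m (2 ^ g) 2))))
               2^[1+g]≤2^D

  2^gδ-bounded : Bounded D (λ k → 2 ^ g * δ k) blockCount
  2^gδ-bounded k _ = ≤-<-trans (*bit≤ (2 ^ g) (δ k) (δ-bit k)) 2^g<2^D

  eval-HT : eval v ρ HT ≡ blocks D Hblock blockCount
  eval-HT = eval-∩-blocks (UT ⊕ (((𝐩 gT) ⊖ (c1 ⊕ c1)) ⊗ ΔT)) (𝐩 gT ⊗ ΔT) _ _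
           (eval-⊕-blocks UT (((𝐩 gT) ⊖ (c1 ⊕ c1)) ⊗ ΔT) Ublock (λ k → twoOffset * δ k) eval-UT (eval-⊗ΔT ((𝐩 gT) ⊖ (c1 ⊕ c1)) twoOffset eval-𝐩gT⊖2 (≤-<-trans (m∸n≤m (2 ^ g) 2) 2^g<2^D)) Utwoblock-bounded)
           (eval-⊗ΔT (𝐩 gT) (2 ^ g) eval-𝐩gT 2^g<2^D) Utwoblock-bounded 2^gδ-bounded

  eval-GT : eval v ρ GT ≡ blocks D Gblock blockCount
  eval-GT = eval-⊗ΔT (𝐩 (gT ⊕ c1)) marker (eval-𝐩 (gT ⊕ c1) (suc g) (trans (eval-⊕ gT c1 g 1 eval-gT refl (<-trans (subst (_< N) (+-comm 1 g) 1+g<N) (nOf<size v))) (+-comm g 1)) 1+g<N) marker<2^D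

  Hblock≤2^g : ∀ k → Hblock k ≤ 2 ^ g
  Hblock≤2^g k = ≤-trans (≤-reflexive (andBits-bitMask D g _ (δ k) (δ-bit k) (≤-trans (n≤1+n (suc g)) g+2≤D)))
            (≤-trans (*-monoʳ-≤ (2 ^ g) (≤-trans (bit*≤ _ (δ k) (δ-bit k)) (≤-pred (m%n<n (div2^ (Ublock k + twoOffset * δ k) g) 2)))) (≤-reflexive (*-identityʳ (2 ^ g))))

  Gblock-bounded : Bounded D Gblock blockCount
  Gblock-bounded k _ = ≤-<-trans (*bit≤ marker (δ k) (δ-bit k)) marker<2^D

  HGblock-bounded : Bounded D (λ k → Hblock k + Gblock k) blockCount
  HGblock-bounded k _ = <-≤-trans (subst (Hblock k + Gblock k <_) (sym (2^[1+p]≡2^p+2^p (suc g))) (+-mono-<-≤ (≤-<-trans (Hblock≤2^g k) (2^-monoʳ-< g (suc g) ≤-refl)) (*bit≤ marker (δ k) (δ-bit k))))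
                (2^-monoʳ-≤ (suc (suc g)) D g+2≤D)

  eval-HT⊕GT : eval v ρ (HT ⊕ GT) ≡ blocks D (λ k → Hblock k + Gblock k) blockCount
  eval-HT⊕GT = eval-⊕-blocks HT GT Hblock Gblock eval-HT eval-GT HGblock-bounded

  Ublock≤Hblock+Gblock : ∀ k → Ublock k ≤ Hblock k + Gblock k
  Ublock≤Hblock+Gblock k = ≤-trans (Ublock≤δS k) (≤-trans (*-monoʳ-≤ (δ k) (<⇒≤ (<-trans S<2^g (2^-monoʳ-< g (suc g) ≤-refl))))
              (≤-trans (≤-reflexive (*-comm (δ k) marker)) (m≤n+m (Gblock k) (Hblock k))))

  eval-HT⊕GT⊖UT : eval v ρ ((HT ⊕ GT) ⊖ UT) ≡ blocks D (λ k → Hblock k + Gblock k ∸ Ublock k) blockCount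
  eval-HT⊕GT⊖UT = trans (eval-⊖ (HT ⊕ GT) UT _ _ eval-HT⊕GT eval-UT (blocks-mono D Ublock _ blockCount (λ k _ → Ublock≤Hblock+Gblock k))
                   (<2^≤totalWidth⇒<Z _ totalWidth (blocks-< D _ blockCount HGblock-bounded) (m≤m+n totalWidth s)))
                (blocks-∸ D _ Ublock blockCount (λ k _ → Ublock≤Hblock+Gblock k))

  eval-φ2 : eval v ρ φ2 ≡ blocks D Rblock blockCount
  eval-φ2 = eval-∩-blocks ((HT ⊕ GT) ⊖ UT) GT _ Gblock eval-HT⊕GT⊖UT eval-GT (λ k k< → ≤-<-trans (m∸n≤m _ (Ublock k)) (HGblock-bounded k k<)) Gblock-bounded

  Xdiag Fdiag : ℕ → ℕ → ℕ
  Xdiag P d = P + overflowOffset * d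
  Fdiag P d = d * (div2^ (Xdiag P d) (s + s) % 2)
  Udiag Hdiag blockResult : ℕ → ℕ → ℕ → ℕ
  Udiag P W d = Fdiag P d + d * W
  Hdiag P W d = andBits D (Udiag P W d + twoOffset * d) (2 ^ g * d)
  blockResult P W d = andBits D (Hdiag P W d + marker * d ∸ Udiag P W d) (marker * d)

  open BlockTest s using (overflow; atLeastTwo; notOne; Matches⇒notOne; notOne⇒Matches)

  blockResult-off : ∀ P W → blockResult P W 0 ≡ marker * 0
  blockResult-off P W = andBits-bitMask D (suc g) _ 0 (inj₁ refl) g+2≤D

  Fdiag-on : ∀ P → Fdiag P 1 ≡ overflow P
  Fdiag-on P = trans (*-identityˡ _) (cong (λ z → div2^ (P + z) (s + s) % 2) (*-identityʳ overflowOffset))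

  Udiag-on : ∀ P W → Udiag P W 1 ≡ overflow P + W
  Udiag-on P W = cong₂ _+_ (Fdiag-on P) (*-identityˡ W)

  Hdiag-on : ∀ P W → Hdiag P W 1 ≡ 2 ^ g * atLeastTwo (overflow P + W)
  Hdiag-on P W = trans (andBits-bitMask D g _ 1 (inj₂ refl) (≤-trans (n≤1+n (suc g)) g+2≤D))
    (cong (2 ^ g *_) (trans (*-identityˡ _) (cong (λ z → div2^ z g % 2) (cong₂ _+_ (Udiag-on P W) (*-identityʳ twoOffset)))))

  blockResult-on : ∀ P W → blockResult P W 1 ≡ marker * notOne (overflow P + W)
  blockResult-on P W = trans (andBits-bitMask D (suc g) _ 1 (inj₂ refl) g+2≤D)
    (cong (marker *_) (trans (*-identityˡ _) (cong (λ z → div2^ z (suc g) % 2)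
      (cong₂ _∸_ (cong₂ _+_ (Hdiag-on P W) (*-identityʳ marker)) (Udiag-on P W)))))

  abBlock-diagonal : ∀ i → i < m → abBlock (i * suc m) ≡ aDigit i * bDigit i
  abBlock-diagonal i i< = cong₂ (λ x y → aDigit x * bDigit y) (trans (cong (_% m) (*-suc i m)) ([r+q*d]%d≡r i i m i<))
                                           (trans (cong (_/ m) (*-suc i m)) ([r+q*d]/d≡q i i m i<))

  digitProduct< : ∀ i → aDigit i * bDigit i < T2
  digitProduct< i = x*y<2^[p+q] _ _ s s (digit<S a i) (digit<S b i)

  Holds : Set
  Holds = R56 u t (a ∷ b ∷ w ∷ [])

  Holds⇒Rblock≡Gblock : Holds → ∀ k → k < blockCount → Rblock k ≡ Gblock k
  Holds⇒Rblock≡Gblock r k k< with δ-bit k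
  ... | inj₁ eq = trans (cong (blockResult (abBlock k) (wDigit (k / suc m))) eq) (trans (blockResult-off (abBlock k) (wDigit (k / suc m))) (cong (marker *_) (sym eq)))
  ... | inj₂ eq = trans (cong (blockResult (abBlock k) (wDigit (k / suc m))) eq) (trans (blockResult-on _ _)
                    (trans (cong (λ P → marker * notOne (overflow P + wDigit i)) Πk) (trans (cong (marker *_) z1) (cong (marker *_) (sym eq)))))
    where
    i : ℕ
    i = k / suc m
    k≡ : k ≡ i * suc m
    k≡ = trans (m≡m%n+[m/n]*n k (suc m)) (cong (_+ i * suc m) (isZero≡1⇒≡0 _ eq))
    i< : i < m
    i< = m<n*o⇒m/o<n {k} {m} {suc m} k<
    Πk : abBlock k ≡ aDigit i * bDigit i
    Πk = trans (cong abBlock k≡) (abBlock-diagonal i i<)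
    z1 : notOne (overflow (aDigit i * bDigit i) + wDigit i) ≡ 1
    z1 = Matches⇒notOne _ _ (digitProduct< i) (digit<S w i) (r i i<)

  Rblock≡Gblock⇒Holds : (∀ k → k < blockCount → Rblock k ≡ Gblock k) → Holds
  Rblock≡Gblock⇒Holds h i i< = notOne⇒Matches _ _ (digitProduct< i) z1
    where
    k : ℕ
    k = i * suc m
    k< : k < blockCount
    k< = *-monoˡ-< (suc m) i<
    eδ : δ k ≡ 1
    eδ = cong isZero (m*n%n≡0 i (suc m))
    ei : k / suc m ≡ i
    ei = m*n/n≡m i (suc m)
    eq : marker * notOne (overflow (aDigit i * bDigit i) + wDigit i) ≡ marker * 1
    eq = begin
        marker * notOne (overflow (aDigit i * bDigit i) + wDigit i)
      ≡⟨ sym (blockResult-on _ _) ⟩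
        blockResult (aDigit i * bDigit i) (wDigit i) 1
      ≡⟨ cong₂ (λ P d → blockResult P (wDigit i) d) (sym (abBlock-diagonal i i<)) (sym eδ) ⟩
        blockResult (abBlock k) (wDigit i) (δ k)
      ≡⟨ cong (λ j → blockResult (abBlock k) (wDigit j) (δ k)) (sym ei) ⟩
        Rblock k
      ≡⟨ h k k< ⟩
        Gblock k
      ≡⟨ cong (marker *_) eδ ⟩
        marker * 1
      ∎
      where open ≡-Reasoning
    z1 : notOne (overflow (aDigit i * bDigit i) + wDigit i) ≡ 1
    z1 = *-cancelˡ-≡ _ _ marker {{m^n≢0 2 (suc g)}} eq

  Rblock-bounded : Bounded D Rblock blockCount
  Rblock-bounded k _ = andBits-< D _ _

  sound : SatQF v ρ (φ2 ≈ GT) → Holds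
  sound sat = Rblock≡Gblock⇒Holds (blocks-injective D Rblock Gblock blockCount Rblock-bounded Gblock-bounded (trans (sym eval-φ2) (trans sat eval-GT)))

  complete : Holds → SatQF v ρ (φ2 ≈ GT)
  complete r = trans eval-φ2 (trans (blocks-cong D Rblock Gblock blockCount (Holds⇒Rblock≡Gblock r)) (sym eval-GT))

abT : Term
abT = var 0 ⊗ var 1

-- a b < 2^n when u = t: the product a ⊗ b does not wrap around modulo 2^N (checked by dividing
-- back by a) and is below 2^n.  When u = v, 𝐩 (𝐩 u) is truncated to 2^n − 1, but then 2^n = 2^N
-- and the first test suffices; 𝐩 u ≈ n detects that case.
productSmall : QF
productSmall = (var 0 ≈ c0) ∨' (((abT ⊘ var 0) ≈ var 1) ∧' (((abT ⊘ 𝐩 (𝐩 uT)) ≈ c0) ∨' (𝐩 uT ≈ cn)))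

φ1 : QF
φ1 = ((¬' (var 2 ≈ c0)) ∨' productSmall) ∧' ((¬' (var 2 ≈ c1)) ∨' (¬' productSmall))

wrapped-product : ∀ a b S .{{_ : NonZero S}} → 1 ≤ a → S ≤ a * b → divZ (a * b % S) a ≢ b
wrapped-product (suc a') b S _ S≤ eq = ≤⇒≯ (≤-trans (≤-reflexive (*-comm (suc a') b)) (≤-trans (≤-reflexive (cong (_* suc a') (sym eq))) (m/n*n≤m _ (suc a'))))
                             (<-≤-trans (m%n<n (suc a' * b) S) S≤)

module SingleBlock (v u a b w : ℕ) (u≤v : u ≤ v) (a< : a < 2 ^ (2 ^ u)) (b< : b < 2 ^ (2 ^ u)) (w< : w < 2 ^ (2 ^ u)) where
  n S : ℕ
  n = 2 ^ u
  S = 2 ^ n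

  ρ : Env
  ρ = envOf (a ∷ b ∷ w ∷ []) u u
  open Eval v ρ

  instance _ = m^n≢0 2 n

  u<N : u < N
  u<N = ≤-<-trans u≤v (n<2^n v)

  eval-𝐩uT : eval v ρ (𝐩 uT) ≡ n
  eval-𝐩uT = eval-𝐩 uT u refl u<N

  n≤N : n ≤ N
  n≤N = 2^-monoʳ-≤ u v u≤v

  S≤Z : S ≤ Z
  S≤Z = 2^-monoʳ-≤ n N n≤N

  ab<SS : a * b < S * S
  ab<SS = *-mono-< a< b<

  productSmall-complete : a * b < S → SatQF v ρ productSmall
  productSmall-complete ab< with a ≟ 0
  ... | yes a≡0 = inj₁ a≡0
  ... | no a≢0 = inj₂ (q , cases (m≤n⇒m<n∨m≡n u≤v))
    where
    instance _ = ≢-nonZero a≢0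
    eval-abT : eval v ρ abT ≡ a * b
    eval-abT = m<n⇒m%n≡m (<-≤-trans ab< S≤Z)
    q : divZ (eval v ρ abT) a ≡ b
    q = trans (cong (λ z → divZ z a) eval-abT) (trans (divZ≡/ (a * b) a) (trans (cong (_/ a) (*-comm a b)) (m*n/n≡m b a)))
    cases : u < v ⊎ u ≡ v → SatQF v ρ (((abT ⊘ 𝐩 (𝐩 uT)) ≈ c0) ∨' (𝐩 uT ≈ cn))
    cases (inj₂ refl) = inj₂ eval-𝐩uT
    cases (inj₁ u<v) = inj₁ (trans (eval-⊘ abT (𝐩 (𝐩 uT)) _ S eval-abT (eval-𝐩 (𝐩 uT) n eval-𝐩uT n<N)) (m<n⇒m/n≡0 ab<))
      where
      n<N : n < N
      n<N = 2^-monoʳ-< u v u<v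

  productSmall-sound : SatQF v ρ productSmall → a * b < S
  productSmall-sound sat with a <? 1
  ... | yes a<1 = subst (λ z → z * b < S) (sym (n<1⇒n≡0 a<1)) (2^>0 n)
  ... | no a≮1 with a * b <? S
  ...   | yes p = p
  ...   | no np = ⊥-elim (no-wraparound sat)
    where
    1≤a : 1 ≤ a
    1≤a = ≮⇒≥ a≮1
    S≤ab : S ≤ a * b
    S≤ab = ≮⇒≥ np
    no-wraparound : SatQF v ρ productSmall → ⊥
    no-wraparound (inj₁ a≡0) = a≮1 (subst (_< 1) (sym a≡0) (s≤s z≤n))
    no-wraparound (inj₂ (q , r)) with m≤n⇒m<n∨m≡n u≤v
    ... | inj₂ refl = wrapped-product a b S 1≤a S≤ab q
    ... | inj₁ u<v with r
    ...   | inj₂ e = <⇒≢ (2^-monoʳ-< u v u<v) (trans (sym eval-𝐩uT) e)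
    ...   | inj₁ r0 = ≤⇒≯ S≤ab (m/n≡0⇒m<n (trans (sym (eval-⊘ abT (𝐩 (𝐩 uT)) _ S eval-abT (eval-𝐩 (𝐩 uT) n eval-𝐩uT n<N))) r0))
      where
      n<N : n < N
      n<N = 2^-monoʳ-< u v u<v
      eval-abT : eval v ρ abT ≡ a * b
      eval-abT = m<n⇒m%n≡m (<-≤-trans ab<SS (subst (_≤ Z) (^-distribˡ-+-* 2 n n) (2^-monoʳ-≤ (n + n) N nn≤N)))
        where
        nn≤N : n + n ≤ N
        nn≤N = ≤-trans (≤-reflexive (cong (n +_) (sym (+-identityʳ n)))) (2^-monoʳ-≤ (suc u) v u<v)

  digit-0≡ : ∀ x → x < S → digit x 0 u ≡ x
  digit-0≡ x x< = trans (cong (λ z → _%_ z S) (n/1≡n x)) (m<n⇒m%n≡m x<)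

  HoldsAt : ℕ → Set
  HoldsAt i = (digit w i u ≡ 0 → digit a i u * digit b i u < 2 ^ (2 ^ u)) ×
           (digit w i u ≡ 1 → digit a i u * digit b i u ≥ 2 ^ (2 ^ u))

  i<1⇒i≡0 : ∀ i → i < 2 ^ (u ∸ u) → i ≡ 0
  i<1⇒i≡0 i i< = n<1⇒n≡0 (subst (i <_) (cong (2 ^_) (n∸n≡0 u)) i<)

  digit-product≡ab : digit a 0 u * digit b 0 u ≡ a * b
  digit-product≡ab = cong₂ _*_ (digit-0≡ a a<) (digit-0≡ b b<)

  complete : R56 u u (a ∷ b ∷ w ∷ []) → SatQF v ρ φ1
  complete r = zeroCase , oneCase
    where
    r0 : HoldsAt 0
    r0 = r 0 (2^>0 (u ∸ u))
    zeroCase : SatQF v ρ ((¬' (var 2 ≈ c0)) ∨' productSmall)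
    zeroCase with w ≟ 0
    ... | yes w0 = inj₂ (productSmall-complete (subst (_< S) digit-product≡ab (proj₁ r0 (trans (digit-0≡ w w<) w0))))
    ... | no nw = inj₁ nw
    oneCase : SatQF v ρ ((¬' (var 2 ≈ c1)) ∨' (¬' productSmall))
    oneCase with w ≟ 1
    ... | yes w1 = inj₂ (λ lt → ≤⇒≯ (subst (S ≤_) digit-product≡ab (proj₂ r0 (trans (digit-0≡ w w<) w1))) (productSmall-sound lt))
    ... | no nw = inj₁ nw

  sound : SatQF v ρ φ1 → R56 u u (a ∷ b ∷ w ∷ [])
  sound (zeroCase , oneCase) i i< = subst HoldsAt (sym (i<1⇒i≡0 i i<)) (zeroCase-sound zeroCase , oneCase-sound oneCase)
    where
    zeroCase-sound : SatQF v ρ ((¬' (var 2 ≈ c0)) ∨' productSmall) → digit w 0 u ≡ 0 → digit a 0 u * digit b 0 u < S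
    zeroCase-sound (inj₁ nw) e = ⊥-elim (nw (trans (sym (digit-0≡ w w<)) e))
    zeroCase-sound (inj₂ lt) e = subst (_< S) (sym digit-product≡ab) (productSmall-sound lt)
    oneCase-sound : SatQF v ρ ((¬' (var 2 ≈ c1)) ∨' (¬' productSmall)) → digit w 0 u ≡ 1 → digit a 0 u * digit b 0 u ≥ S
    oneCase-sound (inj₁ nw) e = ⊥-elim (nw (trans (sym (digit-0≡ w w<)) e))
    oneCase-sound (inj₂ nlt) e = subst (S ≤_) (sym digit-product≡ab) (≮⇒≥ (λ ab< → nlt (productSmall-complete ab<)))

φ : QF
φ = ((uT ≈ tT) ∧' φ1) ∨' ((¬' (uT ≈ tT)) ∧' (φ2 ≈ GT))

lemma56 : PolyExistential 3 R56
lemma56 = 8 , qf φ , correct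
  where
  correct : ∀ v u t → t ≤ u → 8 * (u ∸ t) + t ≤ v →
            (as : Vec ℕ 3) → VAll.All (λ a → a < size u) as →
            (R56 u t as ⇔ Sat v (envOf as u t) (qf φ))
  correct v u t t≤u large (a ∷ b ∷ w ∷ []) (a< VAll.∷ b< VAll.∷ w< VAll.∷ VAll.[]) with u ≟ t
  ... | yes refl = mk⇔ (λ r → inj₁ (refl , complete r))
    λ { (inj₁ (_ , sat)) → sound sat ; (inj₂ (u≢u , _)) → ⊥-elim (u≢u refl) }
    where open SingleBlock v u a b w (m+n≤o⇒n≤o (8 * (u ∸ u)) large) a< b< w<
  ... | no u≢t = mk⇔ (λ r → inj₂ (u≢t , complete r))
    λ { (inj₁ (u≡t , _)) → ⊥-elim (u≢t u≡t) ; (inj₂ (_ , sat)) → sound sat }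
    where open Blockwise v u t a b w (≤∧≢⇒< t≤u (u≢t ∘ sym)) large a< b< w<
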